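{- Let $H\in\mathcal G$ be such that every element $h\in H$, written as $h=\varepsilon_A q$ with $A\in RM(2,4)$ and $q\in Q$, has either $A\in RM(1,4)$ or $A$ of defect $2$, and suppose the orbit $x_0H=\{x_0h:h\in H\}$ has 64 elements. Then: (i) the spherical code $\tfrac14 x_0H$ in $\mathbb{R}^{16}$ has cosine set $\{0,\pm\tfrac14\}$; (ii) the spherical code obtained by orthogonally projecting $x_0H$ onto $v_{\omega_0}^{\perp}$ and rescaling to unit length (in 15 dimensions) has cosine set $\{ -\tfrac13,-\tfrac1{15},\tfrac15\}$; (iii) the spherical code obtained by orthogonally projecting $x_0H$ onto $\mathrm{span}\{v_{\omega_0},v_{\omega_1}\}^{\perp}$ and rescaling to unit length (in 14 dimensions) has cosine set $\{ -\tfrac37,-\tfrac17,\tfrac17\}$.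
   Context: A spherical code is a finite set of unit vectors; its cosines are the inner products of distinct members. Let $\Omega=\mathbb{F}_2^4$, $V=\mathbb{R}^{16}$ with orthonormal basis $(v_\omega)_{\omega\in\Omega}$, $x_0=\sum_\omega v_\omega$. For $A\subseteq\Omega$, $\varepsilon_A$ is the orthogonal map negating $v_\omega$ for $\omega\in A$ and fixing the other $v_\omega$. Subsets of $\Omega$ are identified with binary words (addition = symmetric difference); $RM(1,4)\subset RM(2,4)$ are the Reed–Muller codes on $\Omega$, $RM(r,4)$ being spanned by affine subspaces of codimension $r$. The defect of $A\in RM(2,4)$: $A$ is the support of a Boolean function $F$ of degree $\le2$ on $\mathbb{F}_2^4$, and the alternating form $B_F(u,w)=F(x+u+w)+F(x+u)+F(x+w)+F(x)$ (independent of $x$) has rank $2k$; $k\in\{0,1,2\}$ is the defect of $A$ (defect $0$ iff $A\in RM(1,4)$). Let $\omega_0=0$, fix $\omega_1\in\Omega\setminus\{0\}$, and fix a linear hyperplane $B_0$ of $\Omega$ with $\omega_1\notin B_0$. Let $Q=\{g\in GL(4,2):\omega_1g=\omega_1,\ B_0g=B_0\}\cong GL(3,2)$, acting on $V$ by permutation matrices $v_\omega\mapsto v_{\omega g}$. Let $E=\{\varepsilon_A:A\in RM(1,4),\ \omega_0,\omega_1\notin A\}\cong2^3$ and $J=\{\varepsilon_A:A\in RM(2,4),\ \omega_0,\omega_1\notin A\}$; $Q$ normalizes $J$ and $E$, and $JQ$ is their semidirect product. Let $\mathcal G$ be the set of subgroups $H$ with $E\le H\le JQ$ and $H/E\cong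 GL(3,2)$. -}

module Defs where

open import Data.Bool using (Bool; true; false; _xor_; not; if_then_else_; _∧_; _∨_)
import Data.Bool as Bool
open import Data.Nat using (ℕ; NonZero; _^_; _∸_; _*_)
import Data.Nat as ℕ
open import Data.Fin using (Fin)
import Data.Fin as Fin
open import Data.Vec using (Vec; []; _∷_; lookup; tabulate; replicate; foldr; zipWith; map)
open import Data.Vec.Properties using (≡-dec)
open import Data.Integer using (ℤ; +_; -1ℤ) renaming (_+_ to _+ℤ_; _*_ to _*ℤ_)
open import Data.Rational using (ℚ; _/_)
open import Data.Product using (Σ; _×_; _,_)
open import Data.List using (List)
import Data.List as List
open import Data.List.Relation.Unary.All using (All)
open import Function using (_⇔_)
open import Relation.Binary.PropositionalEquality using (_≡_; _≢_)
open import Relation.Nullary using (Dec; yes; no)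
open import Relation.Nullary.Decidable using (⌊_⌋)

Ω : Set
Ω = Vec Bool 4

_⊕_ : Ω → Ω → Ω
_⊕_ = zipWith _xor_

0Ω : Ω
0Ω = replicate 4 false

_≟Ω_ : (a b : Ω) → Dec (a ≡ b)
_≟Ω_ = ≡-dec Bool._≟_

-- all 16 points of Ω; point number i has binary digits (b3 b2 b1 b0)
allΩ : Vec Ω 16
allΩ =
  (false ∷ false ∷ false ∷ false ∷ []) ∷ (false ∷ false ∷ false ∷ true ∷ []) ∷
  (false ∷ false ∷ true ∷ false ∷ []) ∷ (false ∷ false ∷ true ∷ true ∷ []) ∷
  (false ∷ true ∷ false ∷ false ∷ []) ∷ (false ∷ true ∷ false ∷ true ∷ []) ∷
  (false ∷ true ∷ true ∷ false ∷ []) ∷ (false ∷ true ∷ true ∷ true ∷ []) ∷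
  (true ∷ false ∷ false ∷ false ∷ []) ∷ (true ∷ false ∷ false ∷ true ∷ []) ∷
  (true ∷ false ∷ true ∷ false ∷ []) ∷ (true ∷ false ∷ true ∷ true ∷ []) ∷
  (true ∷ true ∷ false ∷ false ∷ []) ∷ (true ∷ true ∷ false ∷ true ∷ []) ∷
  (true ∷ true ∷ true ∷ false ∷ []) ∷ (true ∷ true ∷ true ∷ true ∷ []) ∷ []

-- the point of Ω labelling coordinate i of V = ℝ¹⁶ (basis vector v_{pt i})
pt : Fin 16 → Ω
pt = lookup allΩ

-- Subsets of Ω = binary words of length 16 (as indicator functions)

SubΩ : Set
SubΩ = Ω → Bool

card : SubΩ → ℕ
card S = foldr (λ _ → ℕ) (λ ω n → (if S ω then 1 else 0) ℕ.+ n) 0 allΩ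

sumSub : List SubΩ → SubΩ
sumSub L ω = List.foldr (λ S b → S ω xor b) false L

IsAffineSubspace : SubΩ → Set
IsAffineSubspace S =
  Σ Ω (λ a → S a ≡ true) ×
  (∀ a b c → S a ≡ true → S b ≡ true → S c ≡ true → S ((a ⊕ b) ⊕ c) ≡ true)

IsAffineCodim : ℕ → SubΩ → Set
IsAffineCodim r S = IsAffineSubspace S × card S ≡ 2 ^ (4 ∸ r)

InRM : ℕ → SubΩ → Set
InRM r A = Σ (List SubΩ) (λ L → All (IsAffineCodim r) L × (∀ ω → A ω ≡ sumSub L ω))

IsLinearHyperplane : SubΩ → Set
IsLinearHyperplane B = B 0Ω ≡ true ×
  (∀ a b → B a ≡ true → B b ≡ true → B (a ⊕ b) ≡ true) × card B ≡ 8

BF : SubΩ → Ω → Ω → Ω → Bool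
BF F x u w = F ((x ⊕ u) ⊕ w) xor F (x ⊕ u) xor F (x ⊕ w) xor F x

-- radical of the alternating form B_F (evaluated at x = 0, B_F is independent of x)
radical : SubΩ → SubΩ
radical F u = foldr (λ _ → Bool) (λ w b → not (BF F 0Ω u w) ∧ b) true allΩ

-- A ∈ RM(2,4) has defect k: rank B_F = 2k, i.e. dim radical = 4 - 2k,
-- i.e. the radical has 2^(4-2k) elements
HasDefect : SubΩ → ℕ → Set
HasDefect A k = InRM 2 A × card (radical A) ≡ 2 ^ (4 ∸ 2 * k)

-- GL(4,2) acting on row vectors: ω ↦ ω g

Mat4 : Set
Mat4 = Vec Ω 4

act : Ω → Mat4 → Ω
act ω g = foldr (λ _ → Ω) _⊕_ 0Ω (zipWith (λ b row → if b then row else 0Ω) ω g)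

IsGL4 : Mat4 → Set
IsGL4 g = Σ Mat4 (λ h → (∀ ω → act (act ω g) h ≡ ω) × (∀ ω → act (act ω h) g ≡ ω))

ω₀ : Ω
ω₀ = 0Ω

InQ : Ω → SubΩ → Mat4 → Set
InQ ω₁ B₀ g = IsGL4 g × act ω₁ g ≡ ω₁ ×
  (∀ η → (B₀ η ≡ true) ⇔ Σ Ω (λ ω → B₀ ω ≡ true × act ω g ≡ η))

-- V = ℝ¹⁶ : we only need integral points; linear maps as 16×16 matrices
-- acting on row vectors (x ↦ x M), coordinates indexed by Fin 16 via pt.

V : Set
V = Vec ℤ 16

Mat : Set
Mat = Vec (Vec ℤ 16) 16

sumℤ : ∀ {n} → Vec ℤ n → ℤ
sumℤ = foldr (λ _ → ℤ) _+ℤ_ (+ 0)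

_·_ : V → V → ℤ
u · v = sumℤ (zipWith _*ℤ_ u v)

col : Fin 16 → Mat → V
col j M = map (λ row → lookup row j) M

_▹_ : V → Mat → V
x ▹ M = tabulate (λ j → x · col j M)

_⊗_ : Mat → Mat → Mat
M ⊗ N = map (λ row → row ▹ N) M

I16 : Mat
I16 = tabulate (λ i → tabulate (λ j → if ⌊ i Fin.≟ j ⌋ then + 1 else + 0))

εM : SubΩ → Mat
εM A = tabulate (λ i → tabulate (λ j →
  if ⌊ i Fin.≟ j ⌋ then (if A (pt i) then -1ℤ else + 1) else + 0))

πM : Mat4 → Mat
πM g = tabulate (λ i → tabulate (λ j →
  if ⌊ pt j ≟Ω act (pt i) g ⌋ then + 1 else + 0))

x₀ : V
x₀ = replicate 16 (+ 1)

InJset : Ω → SubΩ → Set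
InJset ω₁ A = InRM 2 A × A ω₀ ≡ false × A ω₁ ≡ false

InEset : Ω → SubΩ → Set
InEset ω₁ A = InRM 1 A × A ω₀ ≡ false × A ω₁ ≡ false

InE : Ω → Mat → Set
InE ω₁ M = Σ SubΩ (λ A → InEset ω₁ A × M ≡ εM A)

InJQ : Ω → SubΩ → Mat → Set
InJQ ω₁ B₀ M = Σ SubΩ (λ A → Σ Mat4 (λ q →
  InJset ω₁ A × InQ ω₁ B₀ q × M ≡ εM A ⊗ πM q))

Mat3 : Set
Mat3 = Vec (Vec Bool 3) 3

_⊗₃_ : Mat3 → Mat3 → Mat3
m ⊗₃ n = map (λ row → tabulate (λ k →
  foldr (λ _ → Bool) _xor_ false (zipWith (λ a nrow → a ∧ lookup nrow k) row n))) m

I3 : Mat3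
I3 = tabulate (λ i → tabulate (λ j → ⌊ i Fin.≟ j ⌋))

IsGL3 : Mat3 → Set
IsGL3 m = Σ Mat3 (λ n → m ⊗₃ n ≡ I3 × n ⊗₃ m ≡ I3)

IsSubgroup : (Mat → Set) → Set
IsSubgroup H = H I16 ×
  (∀ h k → H h → H k → H (h ⊗ k)) ×
  (∀ h → H h → Σ Mat (λ k → H k × h ⊗ k ≡ I16 × k ⊗ h ≡ I16))

-- H/N ≅ GL(3,2): there is a surjective homomorphism H → GL(3,2) with kernel N
-- (first isomorphism theorem)
QuotientIsoGL32 : (Mat → Set) → (Mat → Set) → Set
QuotientIsoGL32 H N = Σ (Mat → Mat3) (λ φ →
  (∀ h → H h → IsGL3 (φ h)) ×
  (∀ h k → H h → H k → φ (h ⊗ k) ≡ φ h ⊗₃ φ k) ×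
  (∀ m → IsGL3 m → Σ Mat (λ h → H h × φ h ≡ m)) ×
  (∀ h → H h → (φ h ≡ I3) ⇔ N h))

In𝒢 : Ω → SubΩ → (Mat → Set) → Set
In𝒢 ω₁ B₀ H = IsSubgroup H ×
  (∀ M → InE ω₁ M → H M) ×
  (∀ M → H M → InJQ ω₁ B₀ M) ×
  QuotientIsoGL32 H (InE ω₁)

orbit : (Mat → Set) → V → Set
orbit H v = Σ Mat (λ h → H h × v ≡ x₀ ▹ h)

HasSize : (V → Set) → ℕ → Set
HasSize P n = Σ (Vec V n) (λ L →
  (∀ i j → lookup L i ≡ lookup L j → i ≡ j) ×
  (∀ v → P v ⇔ Σ (Fin n) (λ i → lookup L i ≡ v)))

-- orthogonal projection onto span{ v_ω : ω ∈ S }^⊥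
projOff : SubΩ → V → V
projOff S u = tabulate (λ i → if S (pt i) then + 0 else lookup u i)

image : (V → V) → (V → Set) → V → Set
image f C w = Σ V (λ u → C u × w ≡ f u)

-- Cosines of the spherical code obtained from C by rescaling to unit length,
-- for C all of whose members have squared norm r (rescaling = dividing by √r).
IsCosineOf : (C : V → Set) (r : ℕ) .{{_ : NonZero r}} → ℚ → Set
IsCosineOf C r c = Σ V (λ u → Σ V (λ v → C u × C v × u ≢ v × c ≡ (u · v) / r))

HasCosineSet : (C : V → Set) (r : ℕ) .{{_ : NonZero r}} → (ℚ → Set) → Set
HasCosineSet C r S = (∀ u → C u → u · u ≡ + r) × (∀ c → IsCosineOf C r c ⇔ S c)

singleton₀ : SubΩ
singleton₀ ω = ⌊ ω ≟Ω ω₀ ⌋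

pair₀₁ : Ω → SubΩ
pair₀₁ ω₁ ω = ⌊ ω ≟Ω ω₀ ⌋ ∨ ⌊ ω ≟Ω ω₁ ⌋

-- Every element of H acts as a signed permutation ε_A π_q with A ∈ J, and the defect hypothesis
-- pins the weight of A to 0 or 8 (a word of RM(1,4) vanishing at 0 is a linear form) or to 6 or 10
-- (checked over all quadratic forms vanishing at 0).  So every point of x₀H is the sign vector of a
-- word vanishing at ω₀ and ω₁, and as H acts isometrically, ⟨x₀h, x₀k⟩ = 16 - 2|A| for the word A
-- of x₀kh⁻¹: distinct points have inner products in {0, 4, -4}.  Projecting away ω₀ (resp. ω₀ and
-- ω₁), where all points have coordinate 1, lowers norms and inner products by 1 (resp. 2).
--
-- Each value occurs.  0 comes from x₀ and x₀ε_l for a nonzero l ⊥ ω₁.  For a point u of the orbit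
-- other than the 16 points x₀ε_l, orthogonality of the characters l ↦ (-1)^(l ⊙ x) over l ⊥ ω₁
-- gives Σ_l ⟨u, x₀ε_l⟩ = 16 and Σ_l ⟨u, x₀ε_l⟩² = 8 (16 + a(u)) (sums over l ⊥ ω₁), where
-- a(u) = Σ_x u_x u_{x ⊕ ω₁}.  Hence 4 occurs, and -4 occurs unless a(u) = -8.  If a second point u'
-- off the 32 points x₀ε_l, uε_l also has a(u') = -8, the same argument for u against the points
-- u'ε_l, whose correlations are those of the product uu', yields -4, because
-- a(uu') ≥ -16 - a(u) - a(u') = 0.  Such u and u' exist because x₀H has 64 points.

module Submission where

open import Defs
open import Algebra.Bundles using (CommutativeMonoid; CommutativeRing; Semiring)
import Algebra.Properties.CommutativeMonoid.Sum as MonoidSum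
import Algebra.Properties.Semiring.Sum as SemiringSum
open import Data.Bool as Bool using (Bool; true; false; _xor_; not; _∧_; _∨_; if_then_else_)
import Data.Bool.Properties as BoolP
open import Data.Bool.ListAction using (any)
open import Data.Empty using (⊥-elim)
open import Data.Fin as Fin using (Fin; zero; suc; combine)
import Data.Fin.Properties as FinP
open import Data.Fin.Permutation using (Permutation; permutation)
open import Data.Integer as ℤ using (ℤ; +_; -_; -1ℤ; 0ℤ; _+_; _*_; _-_; _≤_; +≤+)
import Data.Integer.Properties as ℤP
open import Data.Integer.Solver using (module +-*-Solver)
open import Data.List using (List; []; _∷_; length)
open import Data.List.Relation.Unary.All using (All; []; _∷_)
open import Data.Nat as ℕ using (ℕ; zero; suc; z≤n; s≤s; NonZero)
import Data.Nat.Properties as ℕP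
open import Data.Product using (Σ; _×_; _,_; proj₁; proj₂)
open import Data.Rational using (ℚ; _/_)
open import Data.Sum using (_⊎_; inj₁; inj₂; [_,_]′)
import Data.Sum
open import Data.Vec using (Vec; []; _∷_; replicate; zipWith; lookup; tabulate; map; foldr; _++_)
import Data.Vec.Membership.DecPropositional as DecMembership
open import Data.Vec.Membership.Propositional using (_∈_; _∉_)
open import Data.Vec.Membership.Propositional.Properties using (∈-lookup; ∈-map⁺; ∈-++⁺ˡ; ∈-++⁺ʳ)
import Data.Vec.Properties as VecP
open import Data.Vec.Relation.Binary.Pointwise.Inductive
  using (Pointwise-≡⇒≡; zipWith-assoc; zipWith-comm; zipWith-identityˡ; zipWith-identityʳ)
import Data.Vec.Relation.Unary.Any as Any
open import Data.Vec.Relation.Unary.Any.Properties using (lookup-index)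
open import Function using (_∘_; id; _⇔_; mk⇔; Equivalence)
open import Relation.Binary.PropositionalEquality
open import Relation.Nullary using (Dec; yes; no; ¬_)
open import Relation.Nullary.Decidable
  using (map′; _×-dec_; _⊎-dec_; _→-dec_; ¬?; from-yes; ⌊_⌋; isYes≗does; dec-true; dec-false; does-⇔; toWitness)
open import Relation.Unary using (Pred; Decidable)

open import Algebra.Properties.CommutativeSemigroup
  (CommutativeRing.+-commutativeSemigroup BoolP.xor-∧-commutativeRing) using (interchange)
open +-*-Solver using (solve; _:=_; _:+_; _:*_; _:-_; con)

module ℕΣ = SemiringSum ℕP.+-*-semiring
module ℤΣ = SemiringSum ℤP.+-*-semiring

-- Deciding statements about Ω by exhaustion

∀-Vec? : ∀ n {p} {P : Pred (Vec Bool n) p} → Decidable P → Dec (∀ v → P v)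
∀-Vec? zero    P? = map′ (λ { p [] → p }) (λ ∀P → ∀P []) (P? [])
∀-Vec? (suc n) P? = map′ (λ { (t , f) (true ∷ v) → t v ; (t , f) (false ∷ v) → f v })
  (λ ∀P → (λ v → ∀P (true ∷ v)) , (λ v → ∀P (false ∷ v)))
  (∀-Vec? n (λ v → P? (true ∷ v)) ×-dec ∀-Vec? n (λ v → P? (false ∷ v)))

∀Ω? : ∀ {p} {P : Pred Ω p} → Decidable P → Dec (∀ ω → P ω)
∀Ω? = ∀-Vec? 4

bit : Bool → Fin 2
bit false = zero
bit true  = suc zero

index : Ω → Fin 16
index (b₃ ∷ b₂ ∷ b₁ ∷ b₀ ∷ []) = combine (bit b₃) (combine (bit b₂) (combine (bit b₁) (bit b₀)))

opaque
  pt∘index : ∀ ω → pt (index ω) ≡ ω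
  pt∘index = from-yes (∀Ω? λ ω → pt (index ω) ≟Ω ω)

opaque
  index∘pt : ∀ i → index (pt i) ≡ i
  index∘pt = from-yes (FinP.all? λ i → index (pt i) FinP.≟ i)

∃Ω? : ∀ {p} {P : Pred Ω p} → Decidable P → Dec (Σ Ω P)
∃Ω? {P = P} P? = map′ (λ (i , p) → pt i , p)
  (λ (ω , p) → index ω , subst P (sym (pt∘index ω)) p) (FinP.any? (P? ∘ pt))

_≗?_ : (S T : SubΩ) → Dec (S ≗ T)
S ≗? T = ∀Ω? λ ω → S ω Bool.≟ T ω

≡true⇒≢false : ∀ {b} → b ≡ true → b ≢ false
≡true⇒≢false refl ()

⌊⌋-true : ∀ {a} {A : Set a} (d : Dec A) → A → ⌊ d ⌋ ≡ true
⌊⌋-true d a = trans (isYes≗does d) (dec-true d a)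

⌊⌋-false : ∀ {a} {A : Set a} (d : Dec A) → ¬ A → ⌊ d ⌋ ≡ false
⌊⌋-false d ¬a = trans (isYes≗does d) (dec-false d ¬a)

⌊⌋-sound : ∀ {a} {A : Set a} (d : Dec A) → ⌊ d ⌋ ≡ true → A
⌊⌋-sound d e = toWitness (Equivalence.from BoolP.T-≡ e)

∨≡true : ∀ a {b} → a ∨ b ≡ true → a ≡ true ⊎ b ≡ true
∨≡true true  _ = inj₁ refl
∨≡true false b = inj₂ b

⊕-assoc : (a b c : Ω) → (a ⊕ b) ⊕ c ≡ a ⊕ (b ⊕ c)
⊕-assoc a b c = Pointwise-≡⇒≡ (zipWith-assoc BoolP.xor-assoc a b c)

⊕-comm : (a b : Ω) → a ⊕ b ≡ b ⊕ a
⊕-comm a b = Pointwise-≡⇒≡ (zipWith-comm BoolP.xor-comm a b)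

⊕-identityˡ : (a : Ω) → 0Ω ⊕ a ≡ a
⊕-identityˡ a = Pointwise-≡⇒≡ (zipWith-identityˡ BoolP.xor-identityˡ a)

⊕-identityʳ : (a : Ω) → a ⊕ 0Ω ≡ a
⊕-identityʳ a = Pointwise-≡⇒≡ (zipWith-identityʳ BoolP.xor-identityʳ a)

⊕-self : (a : Ω) → a ⊕ a ≡ 0Ω
⊕-self (a₁ ∷ a₂ ∷ a₃ ∷ a₄ ∷ []) rewrite BoolP.xor-same a₁ | BoolP.xor-same a₂
  | BoolP.xor-same a₃ | BoolP.xor-same a₄ = refl

⊕-cancelˡ : (a b : Ω) → a ⊕ (a ⊕ b) ≡ b
⊕-cancelˡ a b = begin
  a ⊕ (a ⊕ b) ≡⟨ ⊕-assoc a a b ⟨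
  (a ⊕ a) ⊕ b ≡⟨ cong (_⊕ b) (⊕-self a) ⟩
  0Ω ⊕ b      ≡⟨ ⊕-identityˡ b ⟩
  b           ∎
  where open ≡-Reasoning

⊕-cancelʳ : (a b : Ω) → (a ⊕ b) ⊕ b ≡ a
⊕-cancelʳ a b = begin
  (a ⊕ b) ⊕ b ≡⟨ ⊕-assoc a b b ⟩
  a ⊕ (b ⊕ b) ≡⟨ cong (a ⊕_) (⊕-self b) ⟩
  a ⊕ 0Ω      ≡⟨ ⊕-identityʳ a ⟩
  a           ∎
  where open ≡-Reasoning

infixl 7 _⊙_

_⊙_ : ∀ {n} → Vec Bool n → Vec Bool n → Bool
[]       ⊙ []       = false
(a ∷ as) ⊙ (b ∷ bs) = (a ∧ b) xor (as ⊙ bs)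

⊙-comm : ∀ {n} (a b : Vec Bool n) → a ⊙ b ≡ b ⊙ a
⊙-comm []       []       = refl
⊙-comm (a ∷ as) (b ∷ bs) = cong₂ _xor_ (BoolP.∧-comm a b) (⊙-comm as bs)

⊙-distribʳ-xor : ∀ {n} (a b c : Vec Bool n) → zipWith _xor_ a b ⊙ c ≡ (a ⊙ c) xor (b ⊙ c)
⊙-distribʳ-xor []       []       []       = refl
⊙-distribʳ-xor (a ∷ as) (b ∷ bs) (c ∷ cs) =
  trans (cong₂ _xor_ (BoolP.∧-distribʳ-xor c a b) (⊙-distribʳ-xor as bs cs))
        (interchange (a ∧ c) (b ∧ c) (as ⊙ cs) (bs ⊙ cs))

⊙-distribˡ-xor : ∀ {n} (c a b : Vec Bool n) → c ⊙ zipWith _xor_ a b ≡ (c ⊙ a) xor (c ⊙ b)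
⊙-distribˡ-xor c a b = begin
  c ⊙ zipWith _xor_ a b       ≡⟨ ⊙-comm c _ ⟩
  zipWith _xor_ a b ⊙ c       ≡⟨ ⊙-distribʳ-xor a b c ⟩
  (a ⊙ c) xor (b ⊙ c)         ≡⟨ cong₂ _xor_ (⊙-comm a c) (⊙-comm b c) ⟩
  (c ⊙ a) xor (c ⊙ b)         ∎
  where open ≡-Reasoning

⊙-zeroˡ : ∀ {n} (c : Vec Bool n) → replicate n false ⊙ c ≡ false
⊙-zeroˡ []       = refl
⊙-zeroˡ (c ∷ cs) = ⊙-zeroˡ cs

⊙-zeroʳ : ∀ {n} (c : Vec Bool n) → c ⊙ replicate n false ≡ false
⊙-zeroʳ c = trans (⊙-comm c _) (⊙-zeroˡ c)

module _ {c ℓ} (M : CommutativeMonoid c ℓ) where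
  open CommutativeMonoid M using (Carrier; _≈_)
    renaming (sym to ≈-sym; trans to ≈-trans; reflexive to ≈-reflexive)
  open MonoidSum M using (sum; sum-permute; sum-cong-≗)

  sum-reindex : (f g : Ω → Ω) → (∀ ω → f (g ω) ≡ ω) → (∀ ω → g (f ω) ≡ ω) →
                (h : Ω → Carrier) → sum (λ i → h (f (pt i))) ≈ sum (λ i → h (pt i))
  sum-reindex f g fg gf h =
    ≈-sym (≈-trans (sum-permute (h ∘ pt) π) (≈-reflexive (sum-cong-≗ λ i → cong h (pt∘index (f (pt i))))))
    where
    σ τ : Fin 16 → Fin 16
    σ i = index (f (pt i))
    τ i = index (g (pt i))
    π : Permutation 16 16
    π = permutation σ τ
      (λ i → trans (cong (index ∘ f) (pt∘index (g (pt i)))) (trans (cong index (fg (pt i))) (index∘pt i)))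
      (λ i → trans (cong (index ∘ g) (pt∘index (f (pt i)))) (trans (cong index (gf (pt i))) (index∘pt i)))

𝟙 : Bool → ℕ
𝟙 b = if b then 1 else 0

_⊆_ : SubΩ → SubΩ → Set
S ⊆ T = ∀ ω → S ω ≡ true → T ω ≡ true

_∪_ : SubΩ → SubΩ → SubΩ
(S ∪ T) ω = S ω ∨ T ω

⟦_⟧ : List Ω → SubΩ
⟦ xs ⟧ ω = any (λ a → ⌊ ω ≟Ω a ⌋) xs

card-cong : ∀ {S T} → S ≗ T → card S ≡ card T
card-cong S≗T = ℕΣ.sum-cong-≗ (λ i → cong 𝟙 (S≗T (pt i)))

card-reindex : (f g : Ω → Ω) → (∀ ω → f (g ω) ≡ ω) → (∀ ω → g (f ω) ≡ ω) →
               ∀ S → card (S ∘ f) ≡ card S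
card-reindex f g fg gf S = sum-reindex (Semiring.+-commutativeMonoid ℕP.+-*-semiring) f g fg gf (𝟙 ∘ S)

card-translate : ∀ a S → card (λ ω → S (a ⊕ ω)) ≡ card S
card-translate a = card-reindex (a ⊕_) (a ⊕_) (⊕-cancelˡ a) (⊕-cancelˡ a)

sum-mono : ∀ {n} (f g : Fin n → ℕ) → (∀ i → f i ℕ.≤ g i) → ℕΣ.sum f ℕ.≤ ℕΣ.sum g
sum-mono {zero}  f g f≤g = z≤n
sum-mono {suc n} f g f≤g = ℕP.+-mono-≤ (f≤g zero) (sum-mono (f ∘ suc) (g ∘ suc) (f≤g ∘ suc))

sum-mono-tight : ∀ {n} (f g : Fin n → ℕ) → (∀ i → f i ℕ.≤ g i) → ℕΣ.sum g ℕ.≤ ℕΣ.sum f →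
                 ∀ i → f i ≡ g i
sum-mono-tight {suc n} f g f≤g Σg≤Σf zero = ℕP.≤-antisym (f≤g zero)
  (ℕP.+-cancelʳ-≤ _ _ _ (ℕP.≤-trans Σg≤Σf (ℕP.+-monoʳ-≤ (f zero) (sum-mono (f ∘ suc) (g ∘ suc) (f≤g ∘ suc)))))
sum-mono-tight {suc n} f g f≤g Σg≤Σf (suc i) = sum-mono-tight (f ∘ suc) (g ∘ suc) (f≤g ∘ suc)
  (ℕP.+-cancelˡ-≤ (g zero) _ _ (ℕP.≤-trans Σg≤Σf (ℕP.+-monoˡ-≤ _ (f≤g zero)))) i

𝟙-mono : ∀ {a b} → (a ≡ true → b ≡ true) → 𝟙 a ℕ.≤ 𝟙 b
𝟙-mono {true}  a⇒b rewrite a⇒b refl = ℕP.≤-refl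
𝟙-mono {false} a⇒b = z≤n

𝟙-injective : ∀ {a b} → 𝟙 a ≡ 𝟙 b → a ≡ b
𝟙-injective {true}  {true}  _ = refl
𝟙-injective {false} {false} _ = refl

card-mono : ∀ {S T} → S ⊆ T → card S ℕ.≤ card T
card-mono S⊆T = sum-mono _ _ (λ i → 𝟙-mono (S⊆T (pt i)))

⊆-card-≥⇒≗ : ∀ {S T} → S ⊆ T → card T ℕ.≤ card S → S ≗ T
⊆-card-≥⇒≗ {S} {T} S⊆T card≥ ω = subst (λ ω → S ω ≡ T ω) (pt∘index ω)
  (𝟙-injective (sum-mono-tight _ _ (λ i → 𝟙-mono (S⊆T (pt i))) card≥ (index ω)))

card≡16⇒full : ∀ {S} → card S ≡ 16 → ∀ ω → S ω ≡ true
card≡16⇒full card≡16 = ⊆-card-≥⇒≗ (λ _ _ → refl) (ℕP.≤-reflexive (sym card≡16))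

card-∪-disjoint : ∀ S T → (∀ ω → S ω ∧ T ω ≡ false) → card (S ∪ T) ≡ card S ℕ.+ card T
card-∪-disjoint S T disjoint = trans (ℕΣ.sum-cong-≗ λ i → 𝟙-∨ (S (pt i)) (T (pt i)) (disjoint (pt i)))
  (ℕΣ.∑-distrib-+ (𝟙 ∘ S ∘ pt) (𝟙 ∘ T ∘ pt))
  where
  𝟙-∨ : ∀ a b → a ∧ b ≡ false → 𝟙 (a ∨ b) ≡ 𝟙 a ℕ.+ 𝟙 b
  𝟙-∨ true  false _ = refl
  𝟙-∨ false b     _ = refl

card-∪-≤ : ∀ S T → card (S ∪ T) ℕ.≤ card S ℕ.+ card T
card-∪-≤ S T = ℕP.≤-trans (sum-mono _ _ λ i → 𝟙-∨ (S (pt i)) (T (pt i)))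
  (ℕP.≤-reflexive (ℕΣ.∑-distrib-+ (𝟙 ∘ S ∘ pt) (𝟙 ∘ T ∘ pt)))
  where
  𝟙-∨ : ∀ a b → 𝟙 (a ∨ b) ℕ.≤ 𝟙 a ℕ.+ 𝟙 b
  𝟙-∨ true  b = s≤s z≤n
  𝟙-∨ false b = ℕP.≤-refl

opaque
  card-singleton : ∀ a → card (λ ω → ⌊ ω ≟Ω a ⌋) ≡ 1
  card-singleton = from-yes (∀Ω? λ a → card (λ ω → ⌊ ω ≟Ω a ⌋) ℕ.≟ 1)

opaque
  card-pair₀₁ : ∀ ω₁ → ω₁ ≢ 0Ω → card (pair₀₁ ω₁) ≡ 2
  card-pair₀₁ = from-yes (∀Ω? λ ω₁ → ¬? (ω₁ ≟Ω 0Ω) →-dec (card (pair₀₁ ω₁) ℕ.≟ 2))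

card-⟦⟧ : ∀ xs → card ⟦ xs ⟧ ℕ.≤ length xs
card-⟦⟧ []       = z≤n
card-⟦⟧ (a ∷ xs) = ℕP.≤-trans (card-∪-≤ (λ ω → ⌊ ω ≟Ω a ⌋) ⟦ xs ⟧)
  (ℕP.+-mono-≤ (ℕP.≤-reflexive (card-singleton a)) (card-⟦⟧ xs))

card-⊆-⟦⟧ : ∀ {S} xs → S ⊆ ⟦ xs ⟧ → card S ℕ.≤ length xs
card-⊆-⟦⟧ xs S⊆xs = ℕP.≤-trans (card-mono S⊆xs) (card-⟦⟧ xs)

⟦⟧-⊆ : ∀ {S} xs → All (λ a → S a ≡ true) xs → ⟦ xs ⟧ ⊆ S
⟦⟧-⊆ (a ∷ xs) (Sa ∷ Sxs) ω ω∈ with ω ≟Ω a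
... | yes refl = Sa
... | no  _    = ⟦⟧-⊆ xs Sxs ω ω∈

⟦⟧-∉ : ∀ ω xs → ⟦ xs ⟧ ω ≡ false → All (ω ≢_) xs
⟦⟧-∉ ω []       _   = []
⟦⟧-∉ ω (a ∷ xs) ω∉ with ω ≟Ω a
... | no ω≢a = ω≢a ∷ ⟦⟧-∉ ω xs ω∉

point-outside-or-⊆ : ∀ S xs → (Σ Ω λ ω → S ω ≡ true × ⟦ xs ⟧ ω ≡ false) ⊎ S ⊆ ⟦ xs ⟧
point-outside-or-⊆ S xs with ∃Ω? (λ ω → (S ω Bool.≟ true) ×-dec (⟦ xs ⟧ ω Bool.≟ false))
... | yes found = inj₁ found
... | no  none  = inj₂ λ ω Sω → BoolP.¬-not (λ ω∉ → none (ω , Sω , ω∉))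

-- Weights of Reed–Muller words vanishing at 0

IsAffine : SubΩ → Set
IsAffine f = ∀ a b c → f ((a ⊕ b) ⊕ c) ≡ (f a xor f b) xor f c

⊕-swap₁₂ : ∀ a b c → (a ⊕ b) ⊕ c ≡ (b ⊕ a) ⊕ c
⊕-swap₁₂ a b c = cong (_⊕ c) (⊕-comm a b)

⊕-swap₂₃ : ∀ a b c → (a ⊕ b) ⊕ c ≡ (a ⊕ c) ⊕ b
⊕-swap₂₃ a b c = begin
  (a ⊕ b) ⊕ c ≡⟨ ⊕-assoc a b c ⟩
  a ⊕ (b ⊕ c) ≡⟨ cong (a ⊕_) (⊕-comm b c) ⟩
  a ⊕ (c ⊕ b) ≡⟨ ⊕-assoc a c b ⟨
  (a ⊕ c) ⊕ b ∎
  where open ≡-Reasoning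

module Hyperplane {S : SubΩ} (hyperplane : IsAffineCodim 1 S) where

  private
    closed = proj₂ (proj₁ hyperplane)

  two-in : ∀ {a b c} → S a ≡ true → S b ≡ true → S c ≡ false → S ((a ⊕ b) ⊕ c) ≡ false
  two-in {a} {b} {c} Sa Sb Sc with S ((a ⊕ b) ⊕ c) in Sabc
  ... | false = refl
  ... | true  = ⊥-elim (≡true⇒≢false
    (subst (λ ω → S ω ≡ true) (⊕-cancelˡ (a ⊕ b) c) (closed a b _ Sa Sb Sabc)) Sc)

  -- As b ∉ S, the translates a ⊕ S and b ⊕ S are disjoint halves of Ω; a ⊕ c ∉ a ⊕ S lies in b ⊕ S.
  one-in : ∀ {a b c} → S a ≡ true → S b ≡ false → S c ≡ false → S ((a ⊕ b) ⊕ c) ≡ true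
  one-in {a} {b} {c} Sa Sb Sc = subst (λ ω → S ω ≡ true) b⊕[a⊕c]≡[a⊕b]⊕c
    (trans (cong (_∨ S (b ⊕ (a ⊕ c))) (sym S[a⊕[a⊕c]])) (covered (a ⊕ c)))
    where
    P Q : SubΩ
    P w = S (a ⊕ w)
    Q w = S (b ⊕ w)

    disjoint : ∀ w → P w ∧ Q w ≡ false
    disjoint w with S (a ⊕ w) in Pw | S (b ⊕ w) in Qw
    ... | false | _     = refl
    ... | true  | false = refl
    ... | true  | true  = ⊥-elim (≡true⇒≢false
      (subst (λ ω → S ω ≡ true) (collapse w) (closed a (a ⊕ w) (b ⊕ w) Sa Pw Qw)) Sb)
      where
      collapse : ∀ w → (a ⊕ (a ⊕ w)) ⊕ (b ⊕ w) ≡ b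
      collapse w = trans (cong (_⊕ (b ⊕ w)) (⊕-cancelˡ a w))
                         (trans (cong (w ⊕_) (⊕-comm b w)) (⊕-cancelˡ w b))

    covered : ∀ w → (P ∪ Q) w ≡ true
    covered = card≡16⇒full (trans (card-∪-disjoint P Q disjoint)
      (cong₂ ℕ._+_ (trans (card-translate a S) (proj₂ hyperplane))
                   (trans (card-translate b S) (proj₂ hyperplane))))

    S[a⊕[a⊕c]] : S (a ⊕ (a ⊕ c)) ≡ false
    S[a⊕[a⊕c]] = trans (cong S (⊕-cancelˡ a c)) Sc

    b⊕[a⊕c]≡[a⊕b]⊕c : b ⊕ (a ⊕ c) ≡ (a ⊕ b) ⊕ c
    b⊕[a⊕c]≡[a⊕b]⊕c = trans (sym (⊕-assoc b a c)) (⊕-swap₁₂ b a c)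

  none-in : ∀ {a b c} → S a ≡ false → S b ≡ false → S c ≡ false → S ((a ⊕ b) ⊕ c) ≡ false
  none-in {a} {b} {c} Sa Sb Sc with S ((a ⊕ b) ⊕ c) in Sabc
  ... | false = refl
  ... | true  = ⊥-elim (≡true⇒≢false
    (subst (λ ω → S ω ≡ true) recover (one-in Sabc Sb Sc)) Sa)
    where
    recover : (((a ⊕ b) ⊕ c) ⊕ b) ⊕ c ≡ a
    recover = trans (cong (_⊕ c) (trans (⊕-swap₂₃ (a ⊕ b) c b) (cong (_⊕ c) (⊕-cancelʳ a b))))
                    (⊕-cancelʳ a c)

  affine : IsAffine S
  affine a b c with S a in Sa | S b in Sb | S c in Sc
  ... | true  | true  | true  = closed a b c Sa Sb Sc
  ... | true  | true  | false = two-in Sa Sb Sc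
  ... | true  | false | true  = trans (cong S (⊕-swap₂₃ a b c)) (two-in Sa Sc Sb)
  ... | false | true  | true  = trans (cong S (trans (⊕-swap₁₂ a b c) (⊕-swap₂₃ b a c))) (two-in Sb Sc Sa)
  ... | true  | false | false = one-in Sa Sb Sc
  ... | false | true  | false = trans (cong S (⊕-swap₁₂ a b c)) (one-in Sb Sa Sc)
  ... | false | false | true  = trans (cong S (trans (⊕-swap₂₃ a b c) (⊕-swap₁₂ a c b))) (one-in Sc Sa Sb)
  ... | false | false | false = none-in Sa Sb Sc

affine-xor : ∀ {f g} → IsAffine f → IsAffine g → IsAffine (λ ω → f ω xor g ω)
affine-xor {f} {g} f-affine g-affine a b c = begin
  f abc xor g abc
    ≡⟨ cong₂ _xor_ (f-affine a b c) (g-affine a b c) ⟩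
  ((f a xor f b) xor f c) xor ((g a xor g b) xor g c)
    ≡⟨ interchange (f a xor f b) (f c) (g a xor g b) (g c) ⟩
  ((f a xor f b) xor (g a xor g b)) xor (f c xor g c)
    ≡⟨ cong (_xor (f c xor g c)) (interchange (f a) (f b) (g a) (g b)) ⟩
  ((f a xor g a) xor (f b xor g b)) xor (f c xor g c) ∎
  where
  open ≡-Reasoning
  abc : Ω
  abc = (a ⊕ b) ⊕ c

affine-cong : ∀ {f g} → f ≗ g → IsAffine g → IsAffine f
affine-cong {f} {g} f≗g g-affine a b c = begin
  f ((a ⊕ b) ⊕ c)         ≡⟨ f≗g _ ⟩
  g ((a ⊕ b) ⊕ c)         ≡⟨ g-affine a b c ⟩
  (g a xor g b) xor g c   ≡⟨ cong₂ _xor_ (cong₂ _xor_ (f≗g a) (f≗g b)) (f≗g c) ⟨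
  (f a xor f b) xor f c   ∎
  where open ≡-Reasoning

RM1-affine : ∀ {A} → InRM 1 A → IsAffine A
RM1-affine (L , hyperplanes , A≗ΣL) = affine-cong A≗ΣL (go L hyperplanes)
  where
  go : ∀ L → All (IsAffineCodim 1) L → IsAffine (sumSub L)
  go []      []       a b c = refl
  go (S ∷ L) (H ∷ Hs) = affine-xor {S} {sumSub L} (Hyperplane.affine H) (go L Hs)

affine⇒additive : ∀ {f} → IsAffine f → f 0Ω ≡ false → ∀ a b → f (a ⊕ b) ≡ f a xor f b
affine⇒additive {f} f-affine f0 a b = begin
  f (a ⊕ b)              ≡⟨ cong f (⊕-identityʳ (a ⊕ b)) ⟨
  f ((a ⊕ b) ⊕ 0Ω)       ≡⟨ f-affine a b 0Ω ⟩
  (f a xor f b) xor f 0Ω ≡⟨ cong ((f a xor f b) xor_) f0 ⟩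
  (f a xor f b) xor false ≡⟨ BoolP.xor-identityʳ _ ⟩
  f a xor f b            ∎
  where open ≡-Reasoning

e₁ e₂ e₃ e₄ : Ω
e₁ = true  ∷ false ∷ false ∷ false ∷ []
e₂ = false ∷ true  ∷ false ∷ false ∷ []
e₃ = false ∷ false ∷ true  ∷ false ∷ []
e₄ = false ∷ false ∷ false ∷ true  ∷ []

scale : Bool → Ω → Ω
scale x e = if x then e else 0Ω

expand : Ω → Ω
expand (x₁ ∷ x₂ ∷ x₃ ∷ x₄ ∷ []) = scale x₁ e₁ ⊕ (scale x₂ e₂ ⊕ (scale x₃ e₃ ⊕ (scale x₄ e₄ ⊕ 0Ω)))

opaque
  expand≗id : ∀ ω → expand ω ≡ ω
  expand≗id = from-yes (∀Ω? λ ω → expand ω ≟Ω ω)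

coefficients : SubΩ → Ω
coefficients f = f e₁ ∷ f e₂ ∷ f e₃ ∷ f e₄ ∷ []

affine⇒linear-form : ∀ {f} → IsAffine f → f 0Ω ≡ false → ∀ ω → f ω ≡ coefficients f ⊙ ω
affine⇒linear-form {f} f-affine f0 ω@(x₁ ∷ x₂ ∷ x₃ ∷ x₄ ∷ []) = begin
  f ω
    ≡⟨ cong f (expand≗id ω) ⟨
  f (scale x₁ e₁ ⊕ (scale x₂ e₂ ⊕ (scale x₃ e₃ ⊕ (scale x₄ e₄ ⊕ 0Ω))))
    ≡⟨ add _ _ ⟩
  f (scale x₁ e₁) xor f (scale x₂ e₂ ⊕ (scale x₃ e₃ ⊕ (scale x₄ e₄ ⊕ 0Ω)))
    ≡⟨ cong (f (scale x₁ e₁) xor_) (trans (add _ _) (cong (f (scale x₂ e₂) xor_)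
         (trans (add _ _) (cong (f (scale x₃ e₃) xor_) (add _ _))))) ⟩
  f (scale x₁ e₁) xor (f (scale x₂ e₂) xor (f (scale x₃ e₃) xor (f (scale x₄ e₄) xor f 0Ω)))
    ≡⟨ cong₂ _xor_ (f-scale x₁ e₁) (cong₂ _xor_ (f-scale x₂ e₂)
         (cong₂ _xor_ (f-scale x₃ e₃) (cong₂ _xor_ (f-scale x₄ e₄) f0))) ⟩
  coefficients f ⊙ ω ∎
  where
  open ≡-Reasoning
  add : ∀ a b → f (a ⊕ b) ≡ f a xor f b
  add = affine⇒additive {f} f-affine f0
  f-scale : ∀ x e → f (scale x e) ≡ f e ∧ x
  f-scale true  e = sym (BoolP.∧-identityʳ (f e))
  f-scale false e = trans f0 (sym (BoolP.∧-zeroʳ (f e)))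

opaque
  card-linear-form : ∀ l → l ≢ 0Ω → card (l ⊙_) ≡ 8
  card-linear-form = from-yes (∀Ω? λ l → ¬? (l ≟Ω 0Ω) →-dec (card (l ⊙_) ℕ.≟ 8))

opaque
  linear-form-takes-true : ∀ l → l ≢ 0Ω → Σ Ω λ a → l ⊙ a ≡ true
  linear-form-takes-true = from-yes (∀Ω? λ l → ¬? (l ≟Ω 0Ω) →-dec ∃Ω? (λ a → l ⊙ a Bool.≟ true))

opaque
  ∃-nonzero-annihilator : ∀ ω₁ → Σ Ω λ l → l ≢ 0Ω × l ⊙ ω₁ ≡ false
  ∃-nonzero-annihilator = from-yes (∀Ω? λ ω₁ → ∃Ω? λ l → ¬? (l ≟Ω 0Ω) ×-dec (l ⊙ ω₁ Bool.≟ false))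

linear-form-RM1 : ∀ l → InRM 1 (l ⊙_)
linear-form-RM1 l with l ≟Ω 0Ω
... | yes refl = [] , [] , ⊙-zeroˡ
... | no  l≢0  = (l ⊙_) ∷ [] , hyperplane ∷ [] , λ ω → sym (BoolP.xor-identityʳ (l ⊙ ω))
  where
  closed : ∀ a b c → l ⊙ a ≡ true → l ⊙ b ≡ true → l ⊙ c ≡ true → l ⊙ ((a ⊕ b) ⊕ c) ≡ true
  closed a b c la lb lc rewrite ⊙-distribˡ-xor l (a ⊕ b) c | ⊙-distribˡ-xor l a b | la | lb | lc = refl
  hyperplane : IsAffineCodim 1 (l ⊙_)
  hyperplane = (linear-form-takes-true l l≢0 , closed) , card-linear-form l l≢0

RM1-weight : ∀ {A} → InRM 1 A → A 0Ω ≡ false → card A ≡ 0 ⊎ card A ≡ 8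
RM1-weight {A} A∈RM1 A0 = by-cases (coefficients A ≟Ω 0Ω)
  where
  card-A : card A ≡ card (coefficients A ⊙_)
  card-A = card-cong {A} (affine⇒linear-form (RM1-affine A∈RM1) A0)
  by-cases : Dec (coefficients A ≡ 0Ω) → card A ≡ 0 ⊎ card A ≡ 8
  by-cases (yes l≡0) = inj₁ (trans card-A (cong (λ l → card (l ⊙_)) l≡0))
  by-cases (no  l≢0) = inj₂ (trans card-A (card-linear-form (coefficients A) l≢0))

monomials : Ω → Vec Bool 11
monomials (x₁ ∷ x₂ ∷ x₃ ∷ x₄ ∷ []) =
  true ∷ x₁ ∷ x₂ ∷ x₃ ∷ x₄ ∷ x₁ ∧ x₂ ∷ x₁ ∧ x₃ ∷ x₁ ∧ x₄ ∷ x₂ ∧ x₃ ∷ x₂ ∧ x₄ ∷ x₃ ∧ x₄ ∷ []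

quadratic : Vec Bool 11 → SubΩ
quadratic c ω = c ⊙ monomials ω

-- Möbius inversion: the coefficient of a monomial is the sum of f over the points below it.
anf : SubΩ → Vec Bool 11
anf f = f 0Ω ∷ Δ e₁ ∷ Δ e₂ ∷ Δ e₃ ∷ Δ e₄ ∷
        Δ₂ e₁ e₂ ∷ Δ₂ e₁ e₃ ∷ Δ₂ e₁ e₄ ∷ Δ₂ e₂ e₃ ∷ Δ₂ e₂ e₄ ∷ Δ₂ e₃ e₄ ∷ []
  where
  Δ : Ω → Bool
  Δ x = f x xor f 0Ω
  Δ₂ : Ω → Ω → Bool
  Δ₂ x y = f (x ⊕ y) xor f x xor f y xor f 0Ω

plane : Ω → Ω → Ω → SubΩ
plane a u w = ⟦ a ∷ u ∷ w ∷ (a ⊕ u) ⊕ w ∷ [] ⟧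

opaque
  card-plane : ∀ a u w → u ≢ a → w ≢ a → w ≢ u → card (plane a u w) ≡ 4
  card-plane = from-yes (∀Ω? λ a → ∀Ω? λ u → ∀Ω? λ w →
    ¬? (u ≟Ω a) →-dec (¬? (w ≟Ω a) →-dec (¬? (w ≟Ω u) →-dec (card (plane a u w) ℕ.≟ 4))))

opaque
  plane-quadratic : ∀ a u w → u ≢ a → w ≢ a → w ≢ u → plane a u w ≗ quadratic (anf (plane a u w))
  plane-quadratic = from-yes (∀Ω? λ a → ∀Ω? λ u → ∀Ω? λ w →
    ¬? (u ≟Ω a) →-dec (¬? (w ≟Ω a) →-dec (¬? (w ≟Ω u) →-dec
      (plane a u w ≗? quadratic (anf (plane a u w))))))

codim2⇒plane : ∀ {S} → IsAffineCodim 2 S →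
  Σ Ω λ a → Σ Ω λ u → Σ Ω λ w → u ≢ a × w ≢ a × w ≢ u × S ≗ plane a u w
codim2⇒plane {S} (((a , Sa) , closed) , card≡4) with point-outside-or-⊆ S (a ∷ [])
... | inj₂ S⊆a =
  ⊥-elim (ℕP.<⇒≱ (s≤s (s≤s z≤n)) (subst (ℕ._≤ 1) card≡4 (card-⊆-⟦⟧ (a ∷ []) S⊆a)))
... | inj₁ (u , Su , u∉) with point-outside-or-⊆ S (a ∷ u ∷ [])
...   | inj₂ S⊆au =
  ⊥-elim (ℕP.<⇒≱ (s≤s (s≤s (s≤s z≤n))) (subst (ℕ._≤ 2) card≡4 (card-⊆-⟦⟧ (a ∷ u ∷ []) S⊆au)))
...   | inj₁ (w , Sw , w∉) with ⟦⟧-∉ u (a ∷ []) u∉ | ⟦⟧-∉ w (a ∷ u ∷ []) w∉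
...     | u≢a ∷ [] | w≢a ∷ w≢u ∷ [] = a , u , w , u≢a , w≢a , w≢u , λ ω → sym (plane≗S ω)
  where
  plane⊆S : plane a u w ⊆ S
  plane⊆S = ⟦⟧-⊆ (a ∷ u ∷ w ∷ (a ⊕ u) ⊕ w ∷ []) (Sa ∷ Su ∷ Sw ∷ closed a u w Sa Su Sw ∷ [])
  plane≗S : plane a u w ≗ S
  plane≗S = ⊆-card-≥⇒≗ plane⊆S
    (ℕP.≤-reflexive (trans card≡4 (sym (card-plane a u w u≢a w≢a w≢u))))

IsQuadratic : SubΩ → Set
IsQuadratic f = Σ (Vec Bool 11) λ c → f ≗ quadratic c

quadratic-cong : ∀ {S T} → S ≗ T → IsQuadratic T → IsQuadratic S
quadratic-cong S≗T (c , T≗c) = c , λ ω → trans (S≗T ω) (T≗c ω)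

quadratic-xor : ∀ {S T} → IsQuadratic S → IsQuadratic T → IsQuadratic (λ ω → S ω xor T ω)
quadratic-xor (c , S≗c) (d , T≗d) = zipWith _xor_ c d , λ ω →
  trans (cong₂ _xor_ (S≗c ω) (T≗d ω)) (sym (⊙-distribʳ-xor c d (monomials ω)))

codim2-quadratic : ∀ {S} → IsAffineCodim 2 S → IsQuadratic S
codim2-quadratic S-plane = of-plane (codim2⇒plane S-plane)
  where
  of-plane : ∀ {S} → Σ Ω (λ a → Σ Ω λ u → Σ Ω λ w → u ≢ a × w ≢ a × w ≢ u × S ≗ plane a u w) →
             IsQuadratic S
  of-plane (a , u , w , u≢a , w≢a , w≢u , S≗plane) =
    quadratic-cong S≗plane (anf (plane a u w) , plane-quadratic a u w u≢a w≢a w≢u)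

RM2-quadratic : ∀ {A} → InRM 2 A → IsQuadratic A
RM2-quadratic (L , planes , A≗ΣL) = quadratic-cong A≗ΣL (sum-quadratic L planes)
  where
  sum-quadratic : ∀ L → All (IsAffineCodim 2) L → IsQuadratic (sumSub L)
  sum-quadratic []      []                 = replicate 11 false , λ ω → sym (⊙-zeroˡ (monomials ω))
  sum-quadratic (S ∷ L) (S-plane ∷ planes) =
    quadratic-xor {S} {sumSub L} (codim2-quadratic S-plane) (sum-quadratic L planes)

BF-cong : ∀ {F G} → F ≗ G → ∀ x u w → BF F x u w ≡ BF G x u w
BF-cong F≗G x u w
  rewrite F≗G ((x ⊕ u) ⊕ w) | F≗G (x ⊕ u) | F≗G (x ⊕ w) | F≗G x = refl

radical-cong : ∀ {F G} → F ≗ G → radical F ≗ radical G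
radical-cong {F} {G} F≗G u = go allΩ
  where
  go : ∀ {n} (ws : Vec Ω n) →
       foldr (λ _ → Bool) (λ w b → not (BF F 0Ω u w) ∧ b) true ws ≡
       foldr (λ _ → Bool) (λ w b → not (BF G 0Ω u w) ∧ b) true ws
  go []       = refl
  go (w ∷ ws) = cong₂ _∧_ (cong not (BF-cong F≗G 0Ω u w)) (go ws)

opaque
  defect2-quadratic-weight : ∀ c → quadratic c 0Ω ≡ false → card (radical (quadratic c)) ≡ 1 →
    card (quadratic c) ≡ 6 ⊎ card (quadratic c) ≡ 10
  defect2-quadratic-weight = from-yes (∀-Vec? 11 λ c →
    (quadratic c 0Ω Bool.≟ false) →-dec ((card (radical (quadratic c)) ℕ.≟ 1) →-dec
      ((card (quadratic c) ℕ.≟ 6) ⊎-dec (card (quadratic c) ℕ.≟ 10))))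

defect2-weight : ∀ {A} → HasDefect A 2 → A 0Ω ≡ false → card A ≡ 6 ⊎ card A ≡ 10
defect2-weight {A} (A∈RM2 , card-radical) A0 = of-form (RM2-quadratic A∈RM2)
  where
  of-form : IsQuadratic A → card A ≡ 6 ⊎ card A ≡ 10
  of-form (c , A≗c) = Data.Sum.map (trans (card-cong {A} A≗c)) (trans (card-cong {A} A≗c))
    (defect2-quadratic-weight c (trans (sym (A≗c 0Ω)) A0)
      (trans (sym (card-cong (radical-cong A≗c))) card-radical))

-- Sign vectors and signed permutation matrices

∑Ω : (Ω → ℤ) → ℤ
∑Ω f = ℤΣ.sum (λ i → f (pt i))

∑Ω-cong : ∀ {f g} → (∀ ω → f ω ≡ g ω) → ∑Ω f ≡ ∑Ω g
∑Ω-cong f≗g = ℤΣ.sum-cong-≗ (λ i → f≗g (pt i))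

∑Ω-reindex : (f g : Ω → Ω) → (∀ ω → f (g ω) ≡ ω) → (∀ ω → g (f ω) ≡ ω) →
             ∀ h → ∑Ω (h ∘ f) ≡ ∑Ω h
∑Ω-reindex = sum-reindex (Semiring.+-commutativeMonoid ℤP.+-*-semiring)

≗-lookup⇒≡ : ∀ {n} {A : Set} (u v : Vec A n) → (∀ i → lookup u i ≡ lookup v i) → u ≡ v
≗-lookup⇒≡ u v u≗v = trans (sym (VecP.tabulate∘lookup u))
  (trans (VecP.tabulate-cong u≗v) (VecP.tabulate∘lookup v))

sum-single : ∀ {n} (f : Fin n → ℤ) (i₀ : Fin n) → (∀ i → i ≢ i₀ → f i ≡ 0ℤ) → ℤΣ.sum f ≡ f i₀
sum-single {suc n} f zero f≡0 = begin
  f zero + ℤΣ.sum (f ∘ suc) ≡⟨ cong (_+_ (f zero)) (ℤΣ.sum-cong-≗ λ i → f≡0 (suc i) λ ()) ⟩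
  f zero + ℤΣ.sum {n} (λ _ → 0ℤ) ≡⟨ cong (_+_ (f zero)) (ℤΣ.sum-replicate-zero n) ⟩
  f zero + 0ℤ ≡⟨ ℤP.+-identityʳ (f zero) ⟩
  f zero ∎
  where open ≡-Reasoning
sum-single {suc n} f (suc i₀) f≡0 = begin
  f zero + ℤΣ.sum (f ∘ suc) ≡⟨ cong (_+ ℤΣ.sum (f ∘ suc)) (f≡0 zero λ ()) ⟩
  0ℤ + ℤΣ.sum (f ∘ suc)     ≡⟨ ℤP.+-identityˡ _ ⟩
  ℤΣ.sum (f ∘ suc)          ≡⟨ sum-single (f ∘ suc) i₀ (λ i i≢i₀ → f≡0 (suc i) (i≢i₀ ∘ FinP.suc-injective)) ⟩
  f (suc i₀)                ∎
  where open ≡-Reasoning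

·-lookup : ∀ (u v : V) → u · v ≡ ℤΣ.sum (λ i → lookup u i * lookup v i)
·-lookup u v = trans (foldr-sum (zipWith _*_ u v)) (ℤΣ.sum-cong-≗ λ i → VecP.lookup-zipWith _*_ i u v)
  where
  foldr-sum : ∀ {n} (w : Vec ℤ n) → sumℤ w ≡ ℤΣ.sum (lookup w)
  foldr-sum []      = refl
  foldr-sum (x ∷ w) = cong (_+_ x) (foldr-sum w)

entry : Mat → Fin 16 → Fin 16 → ℤ
entry M i j = lookup (lookup M i) j

▹-lookup : ∀ (x : V) M j → lookup (x ▹ M) j ≡ ℤΣ.sum (λ i → lookup x i * entry M i j)
▹-lookup x M j = trans (VecP.lookup∘tabulate (λ j → x · col j M) j)
  (trans (·-lookup x (col j M)) (ℤΣ.sum-cong-≗ λ i → cong (lookup x i *_) (VecP.lookup-map i (λ row → lookup row j) M)))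

⊗-lookup : ∀ (M N : Mat) i k → entry (M ⊗ N) i k ≡ ℤΣ.sum (λ j → entry M i j * entry N j k)
⊗-lookup M N i k = trans (cong (λ row → lookup row k) (VecP.lookup-map i (_▹ N) M)) (▹-lookup (lookup M i) N k)

▹-assoc : ∀ (x : V) (M N : Mat) → x ▹ (M ⊗ N) ≡ (x ▹ M) ▹ N
▹-assoc x M N = ≗-lookup⇒≡ _ _ λ k → begin
  lookup (x ▹ (M ⊗ N)) k
    ≡⟨ ▹-lookup x (M ⊗ N) k ⟩
  ℤΣ.sum (λ i → lookup x i * entry (M ⊗ N) i k)
    ≡⟨ ℤΣ.sum-cong-≗ (λ i → trans (cong (lookup x i *_) (⊗-lookup M N i k))
                                   (ℤΣ.*-distribˡ-sum (lookup x i) (λ j → entry M i j * entry N j k))) ⟩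
  ℤΣ.sum (λ i → ℤΣ.sum (λ j → lookup x i * (entry M i j * entry N j k)))
    ≡⟨ ℤΣ.∑-comm (λ i j → lookup x i * (entry M i j * entry N j k)) ⟩
  ℤΣ.sum (λ j → ℤΣ.sum (λ i → lookup x i * (entry M i j * entry N j k)))
    ≡⟨ ℤΣ.sum-cong-≗ (λ j → trans (ℤΣ.sum-cong-≗ λ i → sym (ℤP.*-assoc (lookup x i) (entry M i j) (entry N j k)))
                                   (sym (ℤΣ.*-distribʳ-sum (entry N j k) (λ i → lookup x i * entry M i j)))) ⟩
  ℤΣ.sum (λ j → ℤΣ.sum (λ i → lookup x i * entry M i j) * entry N j k)
    ≡⟨ ℤΣ.sum-cong-≗ (λ j → cong (_* entry N j k) (sym (▹-lookup x M j))) ⟩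
  ℤΣ.sum (λ j → lookup (x ▹ M) j * entry N j k)
    ≡⟨ ▹-lookup (x ▹ M) N k ⟨
  lookup ((x ▹ M) ▹ N) k ∎
  where open ≡-Reasoning

sg : Bool → ℤ
sg b = if b then -1ℤ else + 1

sg-xor : ∀ a b → sg a * sg b ≡ sg (a xor b)
sg-xor true  true  = refl
sg-xor true  false = refl
sg-xor false true  = refl
sg-xor false false = refl

sv : SubΩ → V
sv C = tabulate (λ i → sg (C (pt i)))

sv-lookup : ∀ C i → lookup (sv C) i ≡ sg (C (pt i))
sv-lookup C i = VecP.lookup∘tabulate (λ i → sg (C (pt i))) i

sv-cong : ∀ {C D} → C ≗ D → sv C ≡ sv D
sv-cong C≗D = VecP.tabulate-cong λ i → cong sg (C≗D (pt i))

▹ε-lookup : ∀ (y : V) A j → lookup (y ▹ εM A) j ≡ lookup y j * sg (A (pt j))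
▹ε-lookup y A j = trans (▹-lookup y (εM A) j) (trans (sum-single _ j off-diagonal) on-diagonal)
  where
  εM-lookup : ∀ i j → entry (εM A) i j ≡ (if ⌊ i Fin.≟ j ⌋ then sg (A (pt i)) else 0ℤ)
  εM-lookup i j rewrite VecP.lookup∘tabulate (λ i → tabulate λ j → if ⌊ i Fin.≟ j ⌋ then (if A (pt i) then -1ℤ else + 1) else 0ℤ) i
                      | VecP.lookup∘tabulate (λ j → if ⌊ i Fin.≟ j ⌋ then (if A (pt i) then -1ℤ else + 1) else 0ℤ) j
                      with ⌊ i Fin.≟ j ⌋
  ... | true  = refl
  ... | false = refl
  off-diagonal : ∀ i → i ≢ j → lookup y i * entry (εM A) i j ≡ 0ℤ
  off-diagonal i i≢j rewrite εM-lookup i j | ⌊⌋-false (i Fin.≟ j) i≢j = ℤP.*-zeroʳ (lookup y i)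
  on-diagonal : lookup y j * entry (εM A) j j ≡ lookup y j * sg (A (pt j))
  on-diagonal rewrite εM-lookup j j | ⌊⌋-true (j Fin.≟ j) refl = refl

sv▹ε : ∀ C A → sv C ▹ εM A ≡ sv (λ ω → C ω xor A ω)
sv▹ε C A = ≗-lookup⇒≡ _ _ λ j → begin
  lookup (sv C ▹ εM A) j          ≡⟨ ▹ε-lookup (sv C) A j ⟩
  lookup (sv C) j * sg (A (pt j)) ≡⟨ cong (_* sg (A (pt j))) (sv-lookup C j) ⟩
  sg (C (pt j)) * sg (A (pt j))   ≡⟨ sg-xor (C (pt j)) (A (pt j)) ⟩
  sg (C (pt j) xor A (pt j))      ≡⟨ sv-lookup (λ ω → C ω xor A ω) j ⟨
  lookup (sv (λ ω → C ω xor A ω)) j ∎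
  where open ≡-Reasoning

sv▹I : ∀ C → sv C ▹ I16 ≡ sv C
sv▹I C = trans (sv▹ε C (λ _ → false)) (sv-cong λ ω → BoolP.xor-identityʳ (C ω))

AreInverse : Mat4 → Mat4 → Set
AreInverse q r = (∀ ω → act (act ω q) r ≡ ω) × (∀ ω → act (act ω r) q ≡ ω)

▹π-lookup : ∀ (y : V) {q r} → AreInverse q r → ∀ j → lookup (y ▹ πM q) j ≡ lookup y (index (act (pt j) r))
▹π-lookup y {q} {r} (qr , rq) j = trans (▹-lookup y (πM q) j) (trans (sum-single _ i₀ off-image) at-image)
  where
  i₀ : Fin 16
  i₀ = index (act (pt j) r)
  πM-lookup : ∀ i → entry (πM q) i j ≡ (if ⌊ pt j ≟Ω act (pt i) q ⌋ then + 1 else 0ℤ)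
  πM-lookup i = trans (cong (λ row → lookup row j) (VecP.lookup∘tabulate (λ i → tabulate λ j → if ⌊ pt j ≟Ω act (pt i) q ⌋ then + 1 else 0ℤ) i))
                      (VecP.lookup∘tabulate (λ j → if ⌊ pt j ≟Ω act (pt i) q ⌋ then + 1 else 0ℤ) j)
  hits : pt j ≡ act (pt i₀) q
  hits = sym (trans (cong (λ ω → act ω q) (pt∘index (act (pt j) r))) (rq (pt j)))
  only-i₀ : ∀ i → pt j ≡ act (pt i) q → i ≡ i₀
  only-i₀ i e = trans (sym (index∘pt i)) (cong index (trans (sym (qr (pt i))) (cong (λ ω → act ω r) (sym e))))
  off-image : ∀ i → i ≢ i₀ → lookup y i * entry (πM q) i j ≡ 0ℤ
  off-image i i≢i₀ rewrite πM-lookup i | ⌊⌋-false (pt j ≟Ω act (pt i) q) (i≢i₀ ∘ only-i₀ i) = ℤP.*-zeroʳ (lookup y i)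
  at-image : lookup y i₀ * entry (πM q) i₀ j ≡ lookup y i₀
  at-image rewrite πM-lookup i₀ | ⌊⌋-true (pt j ≟Ω act (pt i₀) q) hits = ℤP.*-identityʳ (lookup y i₀)

sv▹π : ∀ C {q r} → AreInverse q r → sv C ▹ πM q ≡ sv (λ ω → C (act ω r))
sv▹π C {q} {r} q⁻¹ = ≗-lookup⇒≡ _ _ λ j → begin
  lookup (sv C ▹ πM q) j                  ≡⟨ ▹π-lookup (sv C) q⁻¹ j ⟩
  lookup (sv C) (index (act (pt j) r))     ≡⟨ sv-lookup C (index (act (pt j) r)) ⟩
  sg (C (pt (index (act (pt j) r))))       ≡⟨ cong (sg ∘ C) (pt∘index (act (pt j) r)) ⟩
  sg (C (act (pt j) r))                    ≡⟨ sv-lookup (λ ω → C (act ω r)) j ⟨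
  lookup (sv (λ ω → C (act ω r))) j        ∎
  where open ≡-Reasoning

sv·sv : ∀ C D → sv C · sv D ≡ ∑Ω (λ ω → sg (C ω) * sg (D ω))
sv·sv C D = trans (·-lookup (sv C) (sv D)) (ℤΣ.sum-cong-≗ λ i → cong₂ _*_ (sv-lookup C i) (sv-lookup D i))

sum-sg : ∀ {n} (b : Fin n → Bool) → ℤΣ.sum (sg ∘ b) + + (2 ℕ.* ℕΣ.sum (𝟙 ∘ b)) ≡ + n
sum-sg {zero}  b = refl
sum-sg {suc n} b = step (b zero) (sum-sg (b ∘ suc))
  where
  R : ℤ
  R = ℤΣ.sum (sg ∘ b ∘ suc)
  c : ℕ
  c = ℕΣ.sum (𝟙 ∘ b ∘ suc)
  step : ∀ x → R + + (2 ℕ.* c) ≡ + n → (sg x + R) + + (2 ℕ.* (𝟙 x ℕ.+ c)) ≡ + suc n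
  step true  ih = begin
    (-1ℤ + R) + + (2 ℕ.* (1 ℕ.+ c))  ≡⟨ cong (_+_ (-1ℤ + R)) (ℤP.pos-* 2 (1 ℕ.+ c)) ⟩
    (-1ℤ + R) + + 2 * (+ 1 + + c)    ≡⟨ solve 2 (λ R c → (con -1ℤ :+ R) :+ con (+ 2) :* (con (+ 1) :+ c)
                                                     := con (+ 1) :+ (R :+ con (+ 2) :* c)) refl R (+ c) ⟩
    + 1 + (R + + 2 * + c)            ≡⟨ cong (λ z → + 1 + (R + z)) (ℤP.pos-* 2 c) ⟨
    + 1 + (R + + (2 ℕ.* c))          ≡⟨ cong (_+_ (+ 1)) ih ⟩
    + 1 + + n                        ∎
    where open ≡-Reasoning
  step false ih = trans (ℤP.+-assoc (+ 1) R _) (cong (_+_ (+ 1)) ih)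

∑Ω-sg : ∀ S → ∑Ω (sg ∘ S) ≡ + 16 - + (2 ℕ.* card S)
∑Ω-sg S = begin
  ∑Ω (sg ∘ S)                                          ≡⟨ solve 2 (λ s k → s := (s :+ k) :- k) refl (∑Ω (sg ∘ S)) (+ (2 ℕ.* card S)) ⟩
  (∑Ω (sg ∘ S) + + (2 ℕ.* card S)) - + (2 ℕ.* card S)  ≡⟨ cong (_- + (2 ℕ.* card S)) (sum-sg (S ∘ pt)) ⟩
  + 16 - + (2 ℕ.* card S)                              ∎
  where open ≡-Reasoning

sv·sv-card : ∀ C D → sv C · sv D ≡ + 16 - + (2 ℕ.* card (λ ω → C ω xor D ω))
sv·sv-card C D = trans (sv·sv C D) (trans (∑Ω-cong λ ω → sg-xor (C ω) (D ω)) (∑Ω-sg (λ ω → C ω xor D ω)))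

sv·sv-self : ∀ C → sv C · sv C ≡ + 16
sv·sv-self C = trans (sv·sv C C) (∑Ω-cong λ ω → trans (sg-xor (C ω) (C ω)) (cong sg (BoolP.xor-same (C ω))))

sum-+ : ∀ {n} (f : Fin n → ℕ) → ℤΣ.sum (λ i → + f i) ≡ + ℕΣ.sum f
sum-+ {zero}  f = refl
sum-+ {suc n} f = trans (cong (_+_ (+ f zero)) (sum-+ (f ∘ suc))) (sym (ℤP.pos-+ (f zero) _))

projOff-sv : ∀ S C i → lookup (projOff S (sv C)) i ≡ (if S (pt i) then 0ℤ else sg (C (pt i)))
projOff-sv S C i = trans (VecP.lookup∘tabulate (λ i → if S (pt i) then 0ℤ else lookup (sv C) i) i)
  (cong (if S (pt i) then 0ℤ else_) (sv-lookup C i))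

projOff·projOff : ∀ S C D → (∀ ω → S ω ≡ true → C ω ≡ false × D ω ≡ false) →
  projOff S (sv C) · projOff S (sv D) ≡ sv C · sv D - + card S
projOff·projOff S C D C,D⊆∁S = begin
  projOff S (sv C) · projOff S (sv D)
    ≡⟨ ·-lookup (projOff S (sv C)) (projOff S (sv D)) ⟩
  ℤΣ.sum (λ i → p C i * p D i)
    ≡⟨ solve 2 (λ x k → x := (x :+ k) :- k) refl (ℤΣ.sum (λ i → p C i * p D i)) (ℤΣ.sum (λ i → + 𝟙 (S (pt i)))) ⟩
  (ℤΣ.sum (λ i → p C i * p D i) + ℤΣ.sum (λ i → + 𝟙 (S (pt i)))) - ℤΣ.sum (λ i → + 𝟙 (S (pt i)))
    ≡⟨ cong₂ _-_ (trans (sym (ℤΣ.∑-distrib-+ (λ i → p C i * p D i) (λ i → + 𝟙 (S (pt i)))))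
                        (ℤΣ.sum-cong-≗ λ i → trans (cong₂ (λ a b → a * b + + 𝟙 (S (pt i))) (projOff-sv S C i) (projOff-sv S D i))
                                                  (pointwise (S (pt i)) (C (pt i)) (D (pt i)) (C,D⊆∁S (pt i)))))
                 (sum-+ (𝟙 ∘ S ∘ pt)) ⟩
  ℤΣ.sum (λ i → sg (C (pt i)) * sg (D (pt i))) - + card S
    ≡⟨ cong (_- + card S) (trans (ℤΣ.sum-cong-≗ λ i → cong₂ _*_ (sv-lookup C i) (sv-lookup D i)) (sym (·-lookup (sv C) (sv D))))  ⟩
  sv C · sv D - + card S ∎
  where
  open ≡-Reasoning
  p : SubΩ → Fin 16 → ℤ
  p E i = lookup (projOff S (sv E)) i
  pointwise : ∀ s c d → (s ≡ true → c ≡ false × d ≡ false) →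
    (if s then 0ℤ else sg c) * (if s then 0ℤ else sg d) + + 𝟙 s ≡ sg c * sg d
  pointwise true  c d vanish with vanish refl
  ... | refl , refl = refl
  pointwise false c d vanish = ℤP.+-identityʳ _

sv-injective : ∀ {C D} → sv C ≡ sv D → C ≗ D
sv-injective {C} {D} svC≡svD ω = sg-injective (begin
  sg (C ω)                    ≡⟨ cong (sg ∘ C) (pt∘index ω) ⟨
  sg (C (pt (index ω)))       ≡⟨ sv-lookup C (index ω) ⟨
  lookup (sv C) (index ω)     ≡⟨ cong (λ u → lookup u (index ω)) svC≡svD ⟩
  lookup (sv D) (index ω)     ≡⟨ sv-lookup D (index ω) ⟩
  sg (D (pt (index ω)))       ≡⟨ cong (sg ∘ D) (pt∘index ω) ⟩
  sg (D ω)                    ∎)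
  where
  open ≡-Reasoning
  sg-injective : ∀ {a b} → sg a ≡ sg b → a ≡ b
  sg-injective {true}  {true}  _ = refl
  sg-injective {false} {false} _ = refl

-- Correlations with the characters of Ω

𝟙ℤ : Bool → ℤ
𝟙ℤ b = if b then + 1 else 0ℤ

δ : Ω → Ω → ℤ
δ a b = 𝟙ℤ ⌊ a ≟Ω b ⌋

δ-translate : ∀ x y a → δ (x ⊕ y) a ≡ δ y (x ⊕ a)
δ-translate x y a = cong 𝟙ℤ (trans (isYes≗does ((x ⊕ y) ≟Ω a))
  (trans (does-⇔ (mk⇔ to from) ((x ⊕ y) ≟Ω a) (y ≟Ω (x ⊕ a))) (sym (isYes≗does (y ≟Ω (x ⊕ a))))))
  where
  to : x ⊕ y ≡ a → y ≡ x ⊕ a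
  to x⊕y≡a = trans (sym (⊕-cancelˡ x y)) (cong (x ⊕_) x⊕y≡a)
  from : y ≡ x ⊕ a → x ⊕ y ≡ a
  from y≡x⊕a = trans (cong (x ⊕_) y≡x⊕a) (⊕-cancelˡ x a)

∑Ω-δ : ∀ (f : Ω → ℤ) a → ∑Ω (λ y → f y * δ y a) ≡ f a
∑Ω-δ f a = trans (sum-single (λ i → f (pt i) * δ (pt i) a) (index a) off-a) at-a
  where
  off-a : ∀ i → i ≢ index a → f (pt i) * δ (pt i) a ≡ 0ℤ
  off-a i i≢a = trans (cong (λ b → f (pt i) * 𝟙ℤ b)
    (⌊⌋-false (pt i ≟Ω a) (λ pt-i≡a → i≢a (trans (sym (index∘pt i)) (cong index pt-i≡a)))))
    (ℤP.*-zeroʳ (f (pt i)))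
  at-a : f (pt (index a)) * δ (pt (index a)) a ≡ f a
  at-a = trans (cong (λ ω → f ω * δ ω a) (pt∘index a))
    (trans (cong (λ b → f a * 𝟙ℤ b) (⌊⌋-true (a ≟Ω a) refl)) (ℤP.*-identityʳ (f a)))

∑Ω-comm : ∀ (f : Ω → Ω → ℤ) → ∑Ω (λ a → ∑Ω (λ b → f a b)) ≡ ∑Ω (λ b → ∑Ω (λ a → f a b))
∑Ω-comm f = ℤΣ.∑-comm (λ i j → f (pt i) (pt j))

*-distribˡ-∑Ω : ∀ c f → c * ∑Ω f ≡ ∑Ω (λ ω → c * f ω)
*-distribˡ-∑Ω c f = ℤΣ.*-distribˡ-sum c (f ∘ pt)

∑Ω-distrib-+ : ∀ f g → ∑Ω (λ ω → f ω + g ω) ≡ ∑Ω f + ∑Ω g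
∑Ω-distrib-+ f g = ℤΣ.∑-distrib-+ (f ∘ pt) (g ∘ pt)

opaque
  character-sum : ∀ ω₁ z → ∑Ω (λ l → 𝟙ℤ (not (l ⊙ ω₁)) * sg (l ⊙ z)) ≡ + 8 * (δ z 0Ω + δ z ω₁)
  character-sum = from-yes (∀Ω? λ ω₁ → ∀Ω? λ z →
    ∑Ω (λ l → 𝟙ℤ (not (l ⊙ ω₁)) * sg (l ⊙ z)) ℤ.≟ + 8 * (δ z 0Ω + δ z ω₁))

correlation : Ω → SubΩ → Ω → ℤ
correlation ω₁ C l = 𝟙ℤ (not (l ⊙ ω₁)) * ∑Ω (λ x → sg (C x) * sg (l ⊙ x))

correlation-annihilator : ∀ {ω₁ C l} → l ⊙ ω₁ ≡ false →
  correlation ω₁ C l ≡ ∑Ω (λ x → sg (C x) * sg (l ⊙ x))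
correlation-annihilator {ω₁} {C} {l} l⊙ω₁≡false =
  trans (cong (λ b → 𝟙ℤ (not b) * ∑Ω (λ x → sg (C x) * sg (l ⊙ x))) l⊙ω₁≡false)
        (ℤP.*-identityˡ (∑Ω (λ x → sg (C x) * sg (l ⊙ x))))

correlation-off-annihilator : ∀ {ω₁ C l} → l ⊙ ω₁ ≡ true → correlation ω₁ C l ≡ 0ℤ
correlation-off-annihilator {ω₁} {C} {l} l⊙ω₁≡true =
  trans (cong (λ b → 𝟙ℤ (not b) * ∑Ω (λ x → sg (C x) * sg (l ⊙ x))) l⊙ω₁≡true)
        (ℤP.*-zeroˡ (∑Ω (λ x → sg (C x) * sg (l ⊙ x))))

autocorrelation : Ω → SubΩ → ℤ
autocorrelation ω₁ C = ∑Ω (λ x → sg (C x xor C (x ⊕ ω₁)))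

sum-correlation : ∀ ω₁ (C : SubΩ) → C 0Ω ≡ false → C ω₁ ≡ false → ∑Ω (correlation ω₁ C) ≡ + 16
sum-correlation ω₁ C C0 C1 = begin
  ∑Ω (λ l → p l * ∑Ω (λ x → s x * e l x))
    ≡⟨ ∑Ω-cong (λ l → *-distribˡ-∑Ω (p l) (λ x → s x * e l x)) ⟩
  ∑Ω (λ l → ∑Ω (λ x → p l * (s x * e l x)))
    ≡⟨ ∑Ω-comm (λ l x → p l * (s x * e l x)) ⟩
  ∑Ω (λ x → ∑Ω (λ l → p l * (s x * e l x)))
    ≡⟨ ∑Ω-cong (λ x → trans (∑Ω-cong λ l → solve 3 (λ p s e → p :* (s :* e) := s :* (p :* e)) refl (p l) (s x) (e l x))
                             (sym (*-distribˡ-∑Ω (s x) (λ l → p l * e l x)))) ⟩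
  ∑Ω (λ x → s x * ∑Ω (λ l → p l * e l x))
    ≡⟨ ∑Ω-cong (λ x → cong (s x *_) (character-sum ω₁ x)) ⟩
  ∑Ω (λ x → s x * (+ 8 * (δ x 0Ω + δ x ω₁)))
    ≡⟨ ∑Ω-cong (λ x → solve 3 (λ s a b → s :* (con (+ 8) :* (a :+ b)) := con (+ 8) :* (s :* a :+ s :* b))
                              refl (s x) (δ x 0Ω) (δ x ω₁)) ⟩
  ∑Ω (λ x → + 8 * (s x * δ x 0Ω + s x * δ x ω₁))
    ≡⟨ *-distribˡ-∑Ω (+ 8) (λ x → s x * δ x 0Ω + s x * δ x ω₁) ⟨
  + 8 * ∑Ω (λ x → s x * δ x 0Ω + s x * δ x ω₁)
    ≡⟨ cong (+ 8 *_) (trans (∑Ω-distrib-+ (λ x → s x * δ x 0Ω) (λ x → s x * δ x ω₁))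
                            (cong₂ _+_ (∑Ω-δ s 0Ω) (∑Ω-δ s ω₁))) ⟩
  + 8 * (s 0Ω + s ω₁)
    ≡⟨ cong₂ (λ a b → + 8 * (sg a + sg b)) C0 C1 ⟩
  + 16 ∎
  where
  open ≡-Reasoning
  p : Ω → ℤ
  p l = 𝟙ℤ (not (l ⊙ ω₁))
  s : Ω → ℤ
  s x = sg (C x)
  e : Ω → Ω → ℤ
  e l x = sg (l ⊙ x)

𝟙ℤ-idem : ∀ b → 𝟙ℤ b * 𝟙ℤ b ≡ 𝟙ℤ b
𝟙ℤ-idem true  = refl
𝟙ℤ-idem false = refl

square-correlation : ∀ ω₁ (C : SubΩ) l → correlation ω₁ C l * correlation ω₁ C l ≡
  ∑Ω (λ x → ∑Ω (λ y → (sg (C x) * sg (C y)) * (𝟙ℤ (not (l ⊙ ω₁)) * sg (l ⊙ (x ⊕ y)))))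
square-correlation ω₁ C l = begin
  (p * F) * (p * F)
    ≡⟨ solve 2 (λ p F → (p :* F) :* (p :* F) := (p :* p) :* (F :* F)) refl p F ⟩
  (p * p) * (F * F)
    ≡⟨ cong (_* (F * F)) (𝟙ℤ-idem (not (l ⊙ ω₁))) ⟩
  p * (F * F)
    ≡⟨ cong (p *_) (trans (ℤΣ.*-distribʳ-sum F (t ∘ pt)) (∑Ω-cong λ x → *-distribˡ-∑Ω (t x) t)) ⟩
  p * ∑Ω (λ x → ∑Ω (λ y → t x * t y))
    ≡⟨ trans (*-distribˡ-∑Ω p (λ x → ∑Ω (λ y → t x * t y)))
             (∑Ω-cong λ x → *-distribˡ-∑Ω p (λ y → t x * t y)) ⟩
  ∑Ω (λ x → ∑Ω (λ y → p * (t x * t y)))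
    ≡⟨ ∑Ω-cong (λ x → ∑Ω-cong λ y → regroup x y) ⟩
  ∑Ω (λ x → ∑Ω (λ y → (sg (C x) * sg (C y)) * (p * sg (l ⊙ (x ⊕ y))))) ∎
  where
  open ≡-Reasoning
  p : ℤ
  p = 𝟙ℤ (not (l ⊙ ω₁))
  t : Ω → ℤ
  t x = sg (C x) * sg (l ⊙ x)
  F : ℤ
  F = ∑Ω t
  regroup : ∀ x y → p * (t x * t y) ≡ (sg (C x) * sg (C y)) * (p * sg (l ⊙ (x ⊕ y)))
  regroup x y = begin
    p * ((sg (C x) * sg (l ⊙ x)) * (sg (C y) * sg (l ⊙ y)))
      ≡⟨ solve 5 (λ p a b c d → p :* ((a :* b) :* (c :* d)) := (a :* c) :* (p :* (b :* d))) refl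
               p (sg (C x)) (sg (l ⊙ x)) (sg (C y)) (sg (l ⊙ y)) ⟩
    (sg (C x) * sg (C y)) * (p * (sg (l ⊙ x) * sg (l ⊙ y)))
      ≡⟨ cong (λ z → (sg (C x) * sg (C y)) * (p * z))
              (trans (sg-xor (l ⊙ x) (l ⊙ y)) (cong sg (sym (⊙-distribˡ-xor l x y)))) ⟩
    (sg (C x) * sg (C y)) * (p * sg (l ⊙ (x ⊕ y))) ∎

-- Only y = x and y = x ⊕ ω₁ survive the character sum.
collapse-pair : ∀ ω₁ (C : SubΩ) x →
  ∑Ω (λ y → (sg (C x) * sg (C y)) * (+ 8 * (δ (x ⊕ y) 0Ω + δ (x ⊕ y) ω₁))) ≡
  + 8 * (+ 1 + sg (C x xor C (x ⊕ ω₁)))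
collapse-pair ω₁ C x = begin
  ∑Ω (λ y → (s x * s y) * (+ 8 * (δ (x ⊕ y) 0Ω + δ (x ⊕ y) ω₁)))
    ≡⟨ ∑Ω-cong (λ y → trans (cong₂ (λ a b → (s x * s y) * (+ 8 * (a + b))) (δ-translate x y 0Ω) (δ-translate x y ω₁))
                            (solve 4 (λ sx sy a b → (sx :* sy) :* (con (+ 8) :* (a :+ b))
                                                   := (con (+ 8) :* sx) :* (sy :* a :+ sy :* b)) refl
                                   (s x) (s y) (δ y (x ⊕ 0Ω)) (δ y (x ⊕ ω₁)))) ⟩
  ∑Ω (λ y → (+ 8 * s x) * (s y * δ y (x ⊕ 0Ω) + s y * δ y (x ⊕ ω₁)))
    ≡⟨ *-distribˡ-∑Ω (+ 8 * s x) (λ y → s y * δ y (x ⊕ 0Ω) + s y * δ y (x ⊕ ω₁)) ⟨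
  (+ 8 * s x) * ∑Ω (λ y → s y * δ y (x ⊕ 0Ω) + s y * δ y (x ⊕ ω₁))
    ≡⟨ cong ((+ 8 * s x) *_) (trans (∑Ω-distrib-+ (λ y → s y * δ y (x ⊕ 0Ω)) (λ y → s y * δ y (x ⊕ ω₁)))
                                    (cong₂ _+_ (∑Ω-δ s (x ⊕ 0Ω)) (∑Ω-δ s (x ⊕ ω₁)))) ⟩
  (+ 8 * s x) * (s (x ⊕ 0Ω) + s (x ⊕ ω₁))
    ≡⟨ cong (λ z → (+ 8 * s x) * (s z + s (x ⊕ ω₁))) (⊕-identityʳ x) ⟩
  (+ 8 * s x) * (s x + s (x ⊕ ω₁))
    ≡⟨ solve 2 (λ a b → (con (+ 8) :* a) :* (a :+ b) := con (+ 8) :* (a :* a :+ a :* b)) refl (s x) (s (x ⊕ ω₁)) ⟩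
  + 8 * (s x * s x + s x * s (x ⊕ ω₁))
    ≡⟨ cong₂ (λ a b → + 8 * (a + b)) (trans (sg-xor (C x) (C x)) (cong sg (BoolP.xor-same (C x))))
                                      (sg-xor (C x) (C (x ⊕ ω₁))) ⟩
  + 8 * (+ 1 + sg (C x xor C (x ⊕ ω₁))) ∎
  where
  open ≡-Reasoning
  s : Ω → ℤ
  s y = sg (C y)

sum-square-correlation : ∀ ω₁ (C : SubΩ) →
  ∑Ω (λ l → correlation ω₁ C l * correlation ω₁ C l) ≡ + 8 * (+ 16 + autocorrelation ω₁ C)
sum-square-correlation ω₁ C = begin
  ∑Ω (λ l → correlation ω₁ C l * correlation ω₁ C l)
    ≡⟨ ∑Ω-cong (square-correlation ω₁ C) ⟩
  ∑Ω (λ l → ∑Ω (λ x → ∑Ω (λ y → f l x y)))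
    ≡⟨ ∑Ω-comm (λ l x → ∑Ω (λ y → f l x y)) ⟩
  ∑Ω (λ x → ∑Ω (λ l → ∑Ω (λ y → f l x y)))
    ≡⟨ ∑Ω-cong (λ x → ∑Ω-comm (λ l y → f l x y)) ⟩
  ∑Ω (λ x → ∑Ω (λ y → ∑Ω (λ l → f l x y)))
    ≡⟨ ∑Ω-cong (λ x → ∑Ω-cong λ y →
         trans (sym (*-distribˡ-∑Ω (s x * s y) (λ l → 𝟙ℤ (not (l ⊙ ω₁)) * sg (l ⊙ (x ⊕ y)))))
               (cong (s x * s y *_) (character-sum ω₁ (x ⊕ y)))) ⟩
  ∑Ω (λ x → ∑Ω (λ y → (s x * s y) * (+ 8 * (δ (x ⊕ y) 0Ω + δ (x ⊕ y) ω₁))))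
    ≡⟨ ∑Ω-cong (collapse-pair ω₁ C) ⟩
  ∑Ω (λ x → + 8 * (+ 1 + sg (C x xor C (x ⊕ ω₁))))
    ≡⟨ *-distribˡ-∑Ω (+ 8) (λ x → + 1 + sg (C x xor C (x ⊕ ω₁))) ⟨
  + 8 * ∑Ω (λ x → + 1 + sg (C x xor C (x ⊕ ω₁)))
    ≡⟨ cong (+ 8 *_) (∑Ω-distrib-+ (λ _ → + 1) (λ x → sg (C x xor C (x ⊕ ω₁)))) ⟩
  + 8 * (+ 16 + autocorrelation ω₁ C) ∎
  where
  open ≡-Reasoning
  s : Ω → ℤ
  s y = sg (C y)
  f : Ω → Ω → Ω → ℤ
  f l x y = (s x * s y) * (𝟙ℤ (not (l ⊙ ω₁)) * sg (l ⊙ (x ⊕ y)))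

InnerValue : ℤ → Set
InnerValue d = d ≡ + 0 ⊎ d ≡ + 4 ⊎ d ≡ - + 4

sum-nonpos : ∀ {n} (f : Fin n → ℤ) → (∀ i → f i ≤ 0ℤ) → ℤΣ.sum f ≤ 0ℤ
sum-nonpos {zero}  f f≤0 = +≤+ z≤n
sum-nonpos {suc n} f f≤0 = ℤP.+-mono-≤ (f≤0 zero) (sum-nonpos (f ∘ suc) (f≤0 ∘ suc))

sum-nonneg : ∀ {n} (f : Fin n → ℤ) → (∀ i → 0ℤ ≤ f i) → 0ℤ ≤ ℤΣ.sum f
sum-nonneg {zero}  f 0≤f = +≤+ z≤n
sum-nonneg {suc n} f 0≤f = ℤP.+-mono-≤ (0≤f zero) (sum-nonneg (f ∘ suc) (0≤f ∘ suc))

module _ (ω₁ : Ω) (C : SubΩ) (values : ∀ l → InnerValue (correlation ω₁ C l)) where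

  correlation-attains-4 : C 0Ω ≡ false → C ω₁ ≡ false → Σ Ω λ l → correlation ω₁ C l ≡ + 4
  correlation-attains-4 C0 C1 = decide (∃Ω? λ l → correlation ω₁ C l ℤ.≟ + 4)
    where
    decide : Dec (Σ Ω λ l → correlation ω₁ C l ≡ + 4) → Σ Ω λ l → correlation ω₁ C l ≡ + 4
    decide (yes found) = found
    decide (no  none)  = ⊥-elim (ℤP.<⇒≱ (ℤ.+<+ (ℕ.s≤s z≤n))
      (subst (_≤ 0ℤ) (sum-correlation ω₁ C C0 C1) (sum-nonpos (correlation ω₁ C ∘ pt) (nonpos ∘ pt))))
      where
      nonpos : ∀ l → correlation ω₁ C l ≤ 0ℤ
      nonpos l with values l
      ... | inj₁ c≡0         = ℤP.≤-reflexive c≡0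
      ... | inj₂ (inj₁ c≡4)  = ⊥-elim (none (l , c≡4))
      ... | inj₂ (inj₂ c≡-4) = ℤP.≤-trans (ℤP.≤-reflexive c≡-4) ℤ.-≤+

  correlation-attains-minus4-or-autocorrelation : C 0Ω ≡ false → C ω₁ ≡ false →
    (Σ Ω λ l → correlation ω₁ C l ≡ - + 4) ⊎ autocorrelation ω₁ C ≡ - + 8
  correlation-attains-minus4-or-autocorrelation C0 C1 = decide (∃Ω? λ l → correlation ω₁ C l ℤ.≟ - + 4)
    where
    c : Ω → ℤ
    c = correlation ω₁ C
    decide : Dec (Σ Ω λ l → c l ≡ - + 4) → (Σ Ω λ l → c l ≡ - + 4) ⊎ autocorrelation ω₁ C ≡ - + 8
    decide (yes found) = inj₁ found
    decide (no  none)  = inj₂ (begin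
      autocorrelation ω₁ C                 ≡⟨ solve 1 (λ a → a := (con (+ 16) :+ a) :- con (+ 16)) refl (autocorrelation ω₁ C) ⟩
      (+ 16 + autocorrelation ω₁ C) - + 16 ≡⟨ cong (_- + 16)
                                                (ℤP.*-cancelˡ-≡ (+ 8) (+ 16 + autocorrelation ω₁ C) (+ 8) 8*[16+A]≡64) ⟩
      - + 8                                ∎)
      where
      open ≡-Reasoning
      square≡4* : ∀ l → c l * c l ≡ + 4 * c l
      square≡4* l with values l
      ... | inj₁ c≡0         rewrite c≡0 = refl
      ... | inj₂ (inj₁ c≡4)  rewrite c≡4 = refl
      ... | inj₂ (inj₂ c≡-4) = ⊥-elim (none (l , c≡-4))
      8*[16+A]≡64 : + 8 * (+ 16 + autocorrelation ω₁ C) ≡ + 8 * + 8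
      8*[16+A]≡64 = begin
        + 8 * (+ 16 + autocorrelation ω₁ C) ≡⟨ sum-square-correlation ω₁ C ⟨
        ∑Ω (λ l → c l * c l)                ≡⟨ ∑Ω-cong square≡4* ⟩
        ∑Ω (λ l → + 4 * c l)                ≡⟨ *-distribˡ-∑Ω (+ 4) c ⟨
        + 4 * ∑Ω c                          ≡⟨ cong (+ 4 *_) (sum-correlation ω₁ C C0 C1) ⟩
        + 8 * + 8                           ∎

-- Pointwise, 1 + sg u + sg v + sg (u xor v) is 4 or 0, so the three autocorrelations
-- sum to at least -16.
autocorrelation-xor : ∀ ω₁ (C D : SubΩ) → autocorrelation ω₁ C ≡ - + 8 → autocorrelation ω₁ D ≡ - + 8 →
  autocorrelation ω₁ (λ x → C x xor D x) ≢ - + 8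
autocorrelation-xor ω₁ C D A[C] A[D] A[C⊕D] = ℤP.<⇒≱ ℤ.-<+ (begin
  0ℤ
    ≤⟨ sum-nonneg (term ∘ pt) (λ i → nonneg (u (pt i)) (v (pt i))) ⟩
  ∑Ω term
    ≡⟨ ∑Ω-distrib-+ (λ x → + 1 + sg (u x) + sg (v x)) (λ x → sg (u x xor v x)) ⟩
  ∑Ω (λ x → + 1 + sg (u x) + sg (v x)) + ∑Ω (λ x → sg (u x xor v x))
    ≡⟨ cong₂ _+_ (trans (∑Ω-distrib-+ (λ x → + 1 + sg (u x)) (sg ∘ v))
                        (cong (_+ ∑Ω (sg ∘ v)) (∑Ω-distrib-+ (λ _ → + 1) (sg ∘ u))))
                 (∑Ω-cong λ x → cong sg (sym (interchange (C x) (D x) (C (x ⊕ ω₁)) (D (x ⊕ ω₁))))) ⟩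
  + 16 + autocorrelation ω₁ C + autocorrelation ω₁ D + autocorrelation ω₁ (λ x → C x xor D x)
    ≡⟨ cong₂ _+_ (cong₂ (λ a b → + 16 + a + b) A[C] A[D]) A[C⊕D] ⟩
  - + 8 ∎)
  where
  open ℤP.≤-Reasoning
  u v : Ω → Bool
  u x = C x xor C (x ⊕ ω₁)
  v x = D x xor D (x ⊕ ω₁)
  term : Ω → ℤ
  term x = + 1 + sg (u x) + sg (v x) + sg (u x xor v x)
  nonneg : ∀ a b → 0ℤ ≤ + 1 + sg a + sg b + sg (a xor b)
  nonneg true  true  = +≤+ z≤n
  nonneg true  false = +≤+ z≤n
  nonneg false true  = +≤+ z≤n
  nonneg false false = +≤+ z≤n

-- The orbit x₀H

pigeonhole-∉ : ∀ {P : V → Set} {n m} → HasSize P n → (xs : Vec V m) → m ℕ.< n → Σ V λ u → P u × u ∉ xs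
pigeonhole-∉ {P} {n} (L , L-injective , P⇔) xs m<n =
  pick (FinP.¬∀⟶∃¬ n (λ i → lookup L i ∈ xs) (λ i → lookup L i ∈? xs) not-all-in)
  where
  open DecMembership (VecP.≡-dec ℤ._≟_) using (_∈?_)
  not-all-in : ¬ (∀ i → lookup L i ∈ xs)
  not-all-in all-in with FinP.pigeonhole m<n (λ i → Any.index (all-in i))
  ... | i , j , i<j , same = ℕP.<-irrefl (cong Fin.toℕ (L-injective i j
    (trans (lookup-index (all-in i)) (trans (cong (lookup xs) same) (sym (lookup-index (all-in j))))))) i<j
  pick : (Σ (Fin n) λ i → lookup L i ∉ xs) → Σ V λ u → P u × u ∉ xs
  pick (i , ∉xs) = lookup L i , Equivalence.from (P⇔ (lookup L i)) (i , refl) , ∉xs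

∈-allΩ : ∀ ω → ω ∈ allΩ
∈-allΩ ω = subst (_∈ allΩ) (pt∘index ω) (∈-lookup (index ω) allΩ)

∉-map-allΩ : ∀ {u} (f : Ω → V) → u ∉ map f allΩ → ∀ ω → u ≢ f ω
∉-map-allΩ f u∉ ω refl = u∉ (∈-map⁺ f (∈-allΩ ω))

HasCosineSet-cong : ∀ {C C' : V → Set} {r} .{{_ : NonZero r}} {T : ℚ → Set} →
  (∀ w → C w ⇔ C' w) → HasCosineSet C r T → HasCosineSet C' r T
HasCosineSet-cong {C} {C'} {r} C⇔C' (norm , cosine⇔T) =
  (λ w C'w → norm w (from (C⇔C' w) C'w)) ,
  λ c → mk⇔ (λ (u , v , C'u , C'v , u≢v , c≡) →
               to (cosine⇔T c) (u , v , from (C⇔C' u) C'u , from (C⇔C' v) C'v , u≢v , c≡))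
            (λ Tc → transport (from (cosine⇔T c) Tc))
  where
  open Equivalence
  transport : ∀ {c} → IsCosineOf C r c → IsCosineOf C' r c
  transport (u , v , Cu , Cv , u≢v , c≡) = u , v , to (C⇔C' u) Cu , to (C⇔C' v) Cv , u≢v , c≡

Weight : ℕ → Set
Weight k = k ≡ 0 ⊎ k ≡ 6 ⊎ k ≡ 8 ⊎ k ≡ 10

Vanishes : SubΩ → Ω → Set
Vanishes C ω₁ = C ω₀ ≡ false × C ω₁ ≡ false

act-0 : ∀ r → act 0Ω r ≡ 0Ω
act-0 (_ ∷ _ ∷ _ ∷ _ ∷ []) = refl

sg-xor-cancel : ∀ c d a → sg (c xor a) * sg (d xor a) ≡ sg c * sg d
sg-xor-cancel true  true  true  = refl
sg-xor-cancel true  true  false = refl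
sg-xor-cancel true  false true  = refl
sg-xor-cancel true  false false = refl
sg-xor-cancel false true  true  = refl
sg-xor-cancel false true  false = refl
sg-xor-cancel false false true  = refl
sg-xor-cancel false false false = refl

module Orbit (ω₁ : Ω) (B₀ : SubΩ) (H : Mat → Set) (H∈𝒢 : In𝒢 ω₁ B₀ H)
  (defect : ∀ h A q → H h → InRM 2 A → InQ ω₁ B₀ q → h ≡ εM A ⊗ πM q → InRM 1 A ⊎ HasDefect A 2) where

  H-identity : H I16
  H-identity = proj₁ (proj₁ H∈𝒢)

  H-closed : ∀ {h k} → H h → H k → H (h ⊗ k)
  H-closed = proj₁ (proj₂ (proj₁ H∈𝒢)) _ _

  H-inverse : ∀ {h} → H h → Σ Mat λ h' → H h' × h ⊗ h' ≡ I16 × h' ⊗ h ≡ I16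
  H-inverse = proj₂ (proj₂ (proj₁ H∈𝒢)) _

  E⊆H : ∀ {M} → InE ω₁ M → H M
  E⊆H = proj₁ (proj₂ H∈𝒢) _

  record SignedPermutation (h : Mat) : Set where
    field
      A : SubΩ
      q r : Mat4
      q⁻¹ : AreInverse q r
      acts : ∀ C → sv C ▹ h ≡ sv (λ ω → C (act ω r) xor A (act ω r))
      vanishes : Vanishes (λ ω → A (act ω r)) ω₁
      weight : Weight (card A)

  signed-permutation : ∀ {h} → H h → SignedPermutation h
  signed-permutation {h} Hh = from-JQ (proj₁ (proj₂ (proj₂ H∈𝒢)) h Hh)
    where
    from-JQ : InJQ ω₁ B₀ h → SignedPermutation h
    from-JQ (A , q , (A∈RM2 , A₀ , A₁) , q∈Q@((r , qr , rq) , q-fixes-ω₁ , _) , h≡εA⊗πq) = record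
      { A = A ; q = q ; r = r ; q⁻¹ = qr , rq
      ; acts = λ C → begin
          sv C ▹ h                        ≡⟨ cong (sv C ▹_) h≡εA⊗πq ⟩
          sv C ▹ (εM A ⊗ πM q)            ≡⟨ ▹-assoc (sv C) (εM A) (πM q) ⟩
          (sv C ▹ εM A) ▹ πM q            ≡⟨ cong (_▹ πM q) (sv▹ε C A) ⟩
          sv (λ ω → C ω xor A ω) ▹ πM q   ≡⟨ sv▹π (λ ω → C ω xor A ω) {q} {r} (qr , rq) ⟩
          sv (λ ω → C (act ω r) xor A (act ω r)) ∎
      ; vanishes = trans (cong A (act-0 r)) A₀
                 , trans (cong A (trans (cong (λ ω → act ω r) (sym q-fixes-ω₁)) (qr ω₁))) A₁
      ; weight = weight (defect h A q Hh A∈RM2 q∈Q h≡εA⊗πq)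
      }
      where
      open ≡-Reasoning
      weight : InRM 1 A ⊎ HasDefect A 2 → Weight (card A)
      weight (inj₁ A∈RM1)     = [ inj₁ , inj₂ ∘ inj₂ ∘ inj₁ ]′ (RM1-weight A∈RM1 A₀)
      weight (inj₂ A-defect2) = [ inj₂ ∘ inj₁ , inj₂ ∘ inj₂ ∘ inj₂ ]′ (defect2-weight A-defect2 A₀)

  isometry : ∀ {h} → H h → ∀ C D → (sv C ▹ h) · (sv D ▹ h) ≡ sv C · sv D
  isometry {h} Hh C D = begin
    (sv C ▹ h) · (sv D ▹ h)
      ≡⟨ cong₂ _·_ (acts C) (acts D) ⟩
    sv (λ ω → C (act ω r) xor A (act ω r)) · sv (λ ω → D (act ω r) xor A (act ω r))
      ≡⟨ sv·sv (λ ω → C (act ω r) xor A (act ω r)) (λ ω → D (act ω r) xor A (act ω r)) ⟩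
    ∑Ω (λ ω → sg (C (act ω r) xor A (act ω r)) * sg (D (act ω r) xor A (act ω r)))
      ≡⟨ ∑Ω-cong (λ ω → sg-xor-cancel (C (act ω r)) (D (act ω r)) (A (act ω r))) ⟩
    ∑Ω (λ ω → sg (C (act ω r)) * sg (D (act ω r)))
      ≡⟨ ∑Ω-reindex (λ ω → act ω r) (λ ω → act ω q) (proj₁ q⁻¹) (proj₂ q⁻¹) (λ ω → sg (C ω) * sg (D ω)) ⟩
    ∑Ω (λ ω → sg (C ω) * sg (D ω))
      ≡⟨ sv·sv C D ⟨
    sv C · sv D ∎
    where
    open ≡-Reasoning
    open SignedPermutation (signed-permutation Hh)

  record Word (u : V) : Set where
    field
      C        : SubΩ
      u≡svC    : u ≡ sv C
      vanishes : Vanishes C ω₁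

  image-of-x₀ : ∀ {h} → H h → Σ SubΩ λ C → x₀ ▹ h ≡ sv C × Vanishes C ω₁ × Weight (card C)
  image-of-x₀ Hh = (λ ω → A (act ω r)) , acts (λ _ → false) , vanishes ,
    subst Weight (sym (card-reindex (λ ω → act ω r) (λ ω → act ω q) (proj₁ q⁻¹) (proj₂ q⁻¹) A)) weight
    where open SignedPermutation (signed-permutation Hh)

  word : ∀ {u} → orbit H u → Word u
  word (h , Hh , u≡x₀h) = record
    { C = proj₁ x₀h ; u≡svC = trans u≡x₀h (proj₁ (proj₂ x₀h)) ; vanishes = proj₁ (proj₂ (proj₂ x₀h)) }
    where x₀h = image-of-x₀ Hh

  orbit-norm : ∀ {u} → orbit H u → u · u ≡ + 16
  orbit-norm u∈ = trans (cong₂ _·_ u≡svC u≡svC) (sv·sv-self C)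
    where open Word (word u∈)

  ▹-cancel : ∀ {h h'} → h ⊗ h' ≡ I16 → ∀ C → (sv C ▹ h) ▹ h' ≡ sv C
  ▹-cancel {h} {h'} h⊗h'≡I C = trans (sym (▹-assoc (sv C) h h')) (trans (cong (sv C ▹_) h⊗h'≡I) (sv▹I C))

  orbit-isometry : ∀ {h u v} → H h → orbit H u → orbit H v → (u ▹ h) · (v ▹ h) ≡ u · v
  orbit-isometry {h} {u} {v} Hh u∈ v∈ = begin
    (u ▹ h) · (v ▹ h)          ≡⟨ cong₂ (λ a b → (a ▹ h) · (b ▹ h)) u≡svCu v≡svCv ⟩
    (sv Cu ▹ h) · (sv Cv ▹ h)  ≡⟨ isometry Hh Cu Cv ⟩
    sv Cu · sv Cv              ≡⟨ cong₂ _·_ u≡svCu v≡svCv ⟨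
    u · v                      ∎
    where
    open ≡-Reasoning
    open Word (word u∈) renaming (C to Cu; u≡svC to u≡svCu)
    open Word (word v∈) renaming (C to Cv; u≡svC to v≡svCv)

  orbit-▹-injective : ∀ {h u v} → H h → orbit H u → orbit H v → u ▹ h ≡ v ▹ h → u ≡ v
  orbit-▹-injective {h} {u} {v} Hh u∈ v∈ u▹h≡v▹h = from-inverse (H-inverse Hh)
    where
    from-inverse : (Σ Mat λ h' → H h' × h ⊗ h' ≡ I16 × h' ⊗ h ≡ I16) → u ≡ v
    from-inverse (h' , _ , h⊗h'≡I , _) = begin
      u                         ≡⟨ Word.u≡svC (word u∈) ⟩
      sv (Word.C (word u∈))     ≡⟨ ▹-cancel h⊗h'≡I (Word.C (word u∈)) ⟨
      (sv (Word.C (word u∈)) ▹ h) ▹ h' ≡⟨ cong (λ a → (a ▹ h) ▹ h') (Word.u≡svC (word u∈)) ⟨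
      (u ▹ h) ▹ h'              ≡⟨ cong (_▹ h') u▹h≡v▹h ⟩
      (v ▹ h) ▹ h'              ≡⟨ cong (λ a → (a ▹ h) ▹ h') (Word.u≡svC (word v∈)) ⟩
      (sv (Word.C (word v∈)) ▹ h) ▹ h' ≡⟨ ▹-cancel h⊗h'≡I (Word.C (word v∈)) ⟩
      sv (Word.C (word v∈))     ≡⟨ Word.u≡svC (word v∈) ⟨
      v                         ∎
      where open ≡-Reasoning

  orbit-dot : ∀ {u v} → orbit H u → orbit H v → u ≡ v ⊎ InnerValue (u · v)
  orbit-dot {u} {v} u∈@(h , Hh , u≡x₀h) v∈@(k , Hk , v≡x₀k) = from-inverse (H-inverse Hh)
    where
    from-inverse : (Σ Mat λ h' → H h' × h ⊗ h' ≡ I16 × h' ⊗ h ≡ I16) → u ≡ v ⊎ InnerValue (u · v)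
    from-inverse (h' , Hh' , h⊗h'≡I , _) = classify (image-of-x₀ (H-closed Hk Hh'))
      where
      u▹h'≡x₀ : u ▹ h' ≡ x₀
      u▹h'≡x₀ = trans (cong (_▹ h') u≡x₀h) (▹-cancel h⊗h'≡I (λ _ → false))
      v▹h'≡ : v ▹ h' ≡ x₀ ▹ (k ⊗ h')
      v▹h'≡ = trans (cong (_▹ h') v≡x₀k) (sym (▹-assoc x₀ k h'))
      classify : (Σ SubΩ λ D → x₀ ▹ (k ⊗ h') ≡ sv D × Vanishes D ω₁ × Weight (card D)) →
                 u ≡ v ⊎ InnerValue (u · v)
      classify (D , x₀▹≡svD , _ , weight) = by-weight weight
        where
        u·v≡card : u · v ≡ + 16 - + (2 ℕ.* card D)
        u·v≡card = trans (sym (orbit-isometry Hh' u∈ v∈))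
          (trans (cong₂ _·_ u▹h'≡x₀ (trans v▹h'≡ x₀▹≡svD)) (sv·sv-card (λ _ → false) D))
        value : ∀ {k d} → card D ≡ k → + 16 - + (2 ℕ.* k) ≡ d → u · v ≡ d
        value card≡k e = trans u·v≡card (trans (cong (λ k → + 16 - + (2 ℕ.* k)) card≡k) e)
        by-weight : Weight (card D) → u ≡ v ⊎ InnerValue (u · v)
        by-weight (inj₁ card≡0) = inj₁ (orbit-▹-injective Hh' u∈ v∈
          (trans u▹h'≡x₀ (trans (sv-cong {λ _ → false} {D} (⊆-card-≥⇒≗ (λ _ ()) (ℕP.≤-reflexive card≡0)))
                                (sym (trans v▹h'≡ x₀▹≡svD)))))
        by-weight (inj₂ (inj₁ card≡6))         = inj₂ (inj₂ (inj₁ (value card≡6 refl)))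
        by-weight (inj₂ (inj₂ (inj₁ card≡8)))  = inj₂ (inj₁ (value card≡8 refl))
        by-weight (inj₂ (inj₂ (inj₂ card≡10))) = inj₂ (inj₂ (inj₂ (value card≡10 refl)))

  linear-point : ∀ l → l ⊙ ω₁ ≡ false → orbit H (sv (l ⊙_))
  linear-point l l⊥ω₁ = εM (l ⊙_) , E⊆H ((l ⊙_) , (linear-form-RM1 l , ⊙-zeroʳ l , l⊥ω₁) , refl) ,
    sym (sv▹ε (λ _ → false) (l ⊙_))

  orbit-▹ε : ∀ {u} → orbit H u → ∀ l → l ⊙ ω₁ ≡ false → orbit H (u ▹ εM (l ⊙_))
  orbit-▹ε (h , Hh , u≡x₀h) l l⊥ω₁ =
    h ⊗ εM (l ⊙_) , H-closed Hh (E⊆H ((l ⊙_) , (linear-form-RM1 l , ⊙-zeroʳ l , l⊥ω₁) , refl)) ,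
    trans (cong (_▹ εM (l ⊙_)) u≡x₀h) (sym (▹-assoc x₀ h (εM (l ⊙_))))

  module Witnesses (size : HasSize (orbit H) 64) where

    Witness : ℤ → Set
    Witness d = Σ V λ u → Σ V λ v → orbit H u × orbit H v × u ≢ v × u · v ≡ d

    witness-0 : Witness (+ 0)
    witness-0 = from-annihilator (∃-nonzero-annihilator ω₁)
      where
      from-annihilator : (Σ Ω λ l → l ≢ 0Ω × l ⊙ ω₁ ≡ false) → Witness (+ 0)
      from-annihilator (l , l≢0 , l⊥ω₁) =
        x₀ , sv (l ⊙_) , (I16 , H-identity , sym (sv▹I (λ _ → false))) , linear-point l l⊥ω₁ , x₀≢ , x₀·x₀l≡0
        where
        x₀·x₀l≡0 : x₀ · sv (l ⊙_) ≡ + 0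
        x₀·x₀l≡0 = trans (sv·sv-card (λ _ → false) (l ⊙_)) (cong (λ k → + 16 - + (2 ℕ.* k)) (card-linear-form l l≢0))
        16≢0 : + 16 ≢ + 0
        16≢0 ()
        x₀≢ : x₀ ≢ sv (l ⊙_)
        x₀≢ x₀≡ = 16≢0 (trans (sym (sv·sv-self (λ _ → false))) (trans (cong (x₀ ·_) x₀≡) x₀·x₀l≡0))

    record Pairing (C : SubΩ) (u : V) (v : Ω → V) : Set where
      field
        u∈       : orbit H u
        v∈       : ∀ l → l ⊙ ω₁ ≡ false → orbit H (v l)
        distinct : ∀ l → l ⊙ ω₁ ≡ false → u ≢ v l
        pairs    : ∀ l → ∑Ω (λ x → sg (C x) * sg (l ⊙ x)) ≡ u · v l

    module _ {C u v} (pairing : Pairing C u v) where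
      open Pairing pairing

      paired-values : ∀ l → InnerValue (correlation ω₁ C l)
      paired-values l = by-cases (l ⊙ ω₁) refl
        where
        by-cases : ∀ b → l ⊙ ω₁ ≡ b → InnerValue (correlation ω₁ C l)
        by-cases true  l⊙ω₁ = inj₁ (correlation-off-annihilator {ω₁} {C} {l} l⊙ω₁)
        by-cases false l⊙ω₁ = [ (λ u≡v → ⊥-elim (distinct l l⊙ω₁ u≡v)) ,
                                 subst InnerValue (sym (trans (correlation-annihilator {ω₁} {C} {l} l⊙ω₁) (pairs l))) ]′
                               (orbit-dot u∈ (v∈ l l⊙ω₁))

      paired-witness : ∀ {d} → d ≢ 0ℤ → Σ Ω (λ l → correlation ω₁ C l ≡ d) → Witness d
      paired-witness {d} d≢0 (l , corr≡d) = by-cases (l ⊙ ω₁) refl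
        where
        by-cases : ∀ b → l ⊙ ω₁ ≡ b → Witness d
        by-cases true  l⊙ω₁ = ⊥-elim (d≢0 (trans (sym corr≡d) (correlation-off-annihilator {ω₁} {C} {l} l⊙ω₁)))
        by-cases false l⊙ω₁ = u , v l , u∈ , v∈ l l⊙ω₁ , distinct l l⊙ω₁ ,
          trans (sym (pairs l)) (trans (sym (correlation-annihilator {ω₁} {C} {l} l⊙ω₁)) corr≡d)

      dichotomy : Vanishes C ω₁ → Witness (+ 4) × (Witness (- + 4) ⊎ autocorrelation ω₁ C ≡ - + 8)
      dichotomy (C-ω₀ , C-ω₁) =
        paired-witness (λ ()) (correlation-attains-4 ω₁ C paired-values C-ω₀ C-ω₁) ,
        [ inj₁ ∘ paired-witness (λ ()) , inj₂ ]′
          (correlation-attains-minus4-or-autocorrelation ω₁ C paired-values C-ω₀ C-ω₁)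

    linear-points : Vec V 16
    linear-points = map (λ l → sv (l ⊙_)) allΩ

    generic-pairing : ∀ {u} (u∈ : orbit H u) → u ∉ linear-points →
                      Pairing (Word.C (word u∈)) u (λ l → sv (l ⊙_))
    generic-pairing {u} u∈ u∉ = record
      { u∈ = u∈
      ; v∈ = linear-point
      ; distinct = λ l _ → ∉-map-allΩ (λ l → sv (l ⊙_)) u∉ l
      ; pairs = λ l → sym (trans (cong (_· sv (l ⊙_)) u≡svC) (sv·sv C (l ⊙_)))
      }
      where open Word (word u∈)

    point₁ : Σ V λ u → orbit H u × u ∉ linear-points
    point₁ = pigeonhole-∉ size linear-points (from-yes (16 ℕ.<? 64))

    u₁ : V
    u₁ = proj₁ point₁
    u₁∈ : orbit H u₁
    u₁∈ = proj₁ (proj₂ point₁)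
    C₁ : SubΩ
    C₁ = Word.C (word u₁∈)

    dichotomy₁ : Witness (+ 4) × (Witness (- + 4) ⊎ autocorrelation ω₁ C₁ ≡ - + 8)
    dichotomy₁ = dichotomy (generic-pairing u₁∈ (proj₂ (proj₂ point₁))) (Word.vanishes (word u₁∈))

    witness-4 : Witness (+ 4)
    witness-4 = proj₁ dichotomy₁

    -- u₂ is taken off these points so that u₁ differs from every u₂ ε_l.
    shifted-points : Vec V 16
    shifted-points = map (λ l → sv (λ x → C₁ x xor l ⊙ x)) allΩ

    point₂ : Σ V λ u → orbit H u × u ∉ linear-points ++ shifted-points
    point₂ = pigeonhole-∉ size (linear-points ++ shifted-points) (from-yes (32 ℕ.<? 64))

    u₂ : V
    u₂ = proj₁ point₂
    u₂∈ : orbit H u₂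
    u₂∈ = proj₁ (proj₂ point₂)
    C₂ : SubΩ
    C₂ = Word.C (word u₂∈)

    dichotomy₂ : Witness (+ 4) × (Witness (- + 4) ⊎ autocorrelation ω₁ C₂ ≡ - + 8)
    dichotomy₂ = dichotomy (generic-pairing u₂∈ (proj₂ (proj₂ point₂) ∘ ∈-++⁺ˡ)) (Word.vanishes (word u₂∈))

    cross-pairing : Pairing (λ x → C₁ x xor C₂ x) u₁ (λ l → u₂ ▹ εM (l ⊙_))
    cross-pairing = record
      { u∈ = u₁∈
      ; v∈ = orbit-▹ε u₂∈
      ; distinct = λ l _ u₁≡ → u₂∉shifted l
          (sv-cong (C₂≗C₁⊕l l (sv-injective (trans (sym u₁≡svC₁) (trans u₁≡ (u₂▹εl≡ {l}))))))
      ; pairs = λ l → begin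
          ∑Ω (λ x → sg (C₁ x xor C₂ x) * sg (l ⊙ x))   ≡⟨ ∑Ω-cong (λ x → regroup (C₁ x) (C₂ x) (l ⊙ x)) ⟩
          ∑Ω (λ x → sg (C₁ x) * sg (C₂ x xor l ⊙ x))   ≡⟨ sv·sv C₁ (λ x → C₂ x xor l ⊙ x) ⟨
          sv C₁ · sv (λ x → C₂ x xor l ⊙ x)            ≡⟨ cong₂ _·_ u₁≡svC₁ (u₂▹εl≡ {l}) ⟨
          u₁ · (u₂ ▹ εM (l ⊙_))                        ∎
      }
      where
      open ≡-Reasoning
      u₁≡svC₁ : u₁ ≡ sv C₁
      u₁≡svC₁ = Word.u≡svC (word u₁∈)
      u₂▹εl≡ : ∀ {l} → u₂ ▹ εM (l ⊙_) ≡ sv (λ x → C₂ x xor l ⊙ x)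
      u₂▹εl≡ {l} = trans (cong (_▹ εM (l ⊙_)) (Word.u≡svC (word u₂∈))) (sv▹ε C₂ (l ⊙_))
      u₂∉shifted : ∀ l → sv C₂ ≢ sv (λ x → C₁ x xor l ⊙ x)
      u₂∉shifted l e = ∉-map-allΩ (λ l → sv (λ x → C₁ x xor l ⊙ x))
        (proj₂ (proj₂ point₂) ∘ ∈-++⁺ʳ linear-points) l (trans (Word.u≡svC (word u₂∈)) e)
      C₂≗C₁⊕l : ∀ l → C₁ ≗ (λ x → C₂ x xor l ⊙ x) → C₂ ≗ (λ x → C₁ x xor l ⊙ x)
      C₂≗C₁⊕l l C₁≗ x = trans (sym (trans (BoolP.xor-assoc (C₂ x) (l ⊙ x) (l ⊙ x))
                                         (trans (cong (C₂ x xor_) (BoolP.xor-same (l ⊙ x))) (BoolP.xor-identityʳ (C₂ x)))))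
                              (cong (_xor l ⊙ x) (sym (C₁≗ x)))
      regroup : ∀ a b c → sg (a xor b) * sg c ≡ sg a * sg (b xor c)
      regroup a b c = trans (sg-xor (a xor b) c) (trans (cong sg (BoolP.xor-assoc a b c)) (sym (sg-xor a (b xor c))))

    witness-minus4 : Witness (- + 4)
    witness-minus4 = [ id , via-u₂ ]′ (proj₂ dichotomy₁)
      where
      via-u₂ : autocorrelation ω₁ C₁ ≡ - + 8 → Witness (- + 4)
      via-u₂ A₁ = [ id , via-cross ]′ (proj₂ dichotomy₂)
        where
        via-cross : autocorrelation ω₁ C₂ ≡ - + 8 → Witness (- + 4)
        via-cross A₂ = [ id , (λ A₁₂ → ⊥-elim (autocorrelation-xor ω₁ C₁ C₂ A₁ A₂ A₁₂)) ]′
          (proj₂ (dichotomy cross-pairing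
            (cong₂ _xor_ (proj₁ (Word.vanishes (word u₁∈))) (proj₁ (Word.vanishes (word u₂∈))) ,
             cong₂ _xor_ (proj₂ (Word.vanishes (word u₁∈))) (proj₂ (Word.vanishes (word u₂∈))))))

    witness : ∀ {d} → InnerValue d → Witness d
    witness (inj₁ refl)        = witness-0
    witness (inj₂ (inj₁ refl)) = witness-4
    witness (inj₂ (inj₂ refl)) = witness-minus4

    projection-dot : ∀ S → (∀ ω → S ω ≡ true → ω ≡ ω₀ ⊎ ω ≡ ω₁) → ∀ {u v} → orbit H u → orbit H v →
                     projOff S u · projOff S v ≡ u · v - + card S
    projection-dot S S⊆ω₀ω₁ {u} {v} u∈ v∈ = begin
      projOff S u · projOff S v
        ≡⟨ cong₂ (λ a b → projOff S a · projOff S b) (Word.u≡svC (word u∈)) (Word.u≡svC (word v∈)) ⟩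
      projOff S (sv Cu) · projOff S (sv Cv)
        ≡⟨ projOff·projOff S Cu Cv (λ ω Sω → vanishes-on (word u∈) ω Sω , vanishes-on (word v∈) ω Sω) ⟩
      sv Cu · sv Cv - + card S
        ≡⟨ cong₂ (λ a b → a · b - + card S) (Word.u≡svC (word u∈)) (Word.u≡svC (word v∈)) ⟨
      u · v - + card S ∎
      where
      open ≡-Reasoning
      Cu Cv : SubΩ
      Cu = Word.C (word u∈)
      Cv = Word.C (word v∈)
      vanishes-on : ∀ {w} (W : Word w) ω → S ω ≡ true → Word.C W ω ≡ false
      vanishes-on W ω Sω = [ (λ ω≡ω₀ → trans (cong (Word.C W) ω≡ω₀) (proj₁ (Word.vanishes W)))
                           , (λ ω≡ω₁ → trans (cong (Word.C W) ω≡ω₁) (proj₂ (Word.vanishes W))) ]′ (S⊆ω₀ω₁ ω Sω)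

    inner-value≢16 : ∀ {d} → InnerValue d → d ≢ + 16
    inner-value≢16 (inj₁ refl)        ()
    inner-value≢16 (inj₂ (inj₁ refl)) ()
    inner-value≢16 (inj₂ (inj₂ refl)) ()

    image-cosines : (P : V → V) (s r : ℕ) .{{_ : NonZero r}} →
      (∀ {u v} → orbit H u → orbit H v → P u · P v ≡ u · v - + s) → + 16 - + s ≡ + r →
      (T : ℚ → Set) → (∀ d → InnerValue d → T ((d - + s) / r)) →
      (∀ c → T c → Σ ℤ λ d → InnerValue d × c ≡ (d - + s) / r) →
      HasCosineSet (image P (orbit H)) r T
    image-cosines P s r P-dot 16-s≡r T values realised = norm , λ c → mk⇔ (cosine⇒T c) (T⇒cosine c)
      where
      norm : ∀ w → image P (orbit H) w → w · w ≡ + r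
      norm w (u , u∈ , w≡Pu) =
        trans (cong₂ _·_ w≡Pu w≡Pu) (trans (P-dot u∈ u∈) (trans (cong (_- + s) (orbit-norm u∈)) 16-s≡r))
      cosine⇒T : ∀ c → IsCosineOf (image P (orbit H)) r c → T c
      cosine⇒T c (w , w' , (u , u∈ , w≡Pu) , (v , v∈ , w'≡Pv) , w≢w' , c≡) =
        [ (λ u≡v → ⊥-elim (w≢w' (trans w≡Pu (trans (cong P u≡v) (sym w'≡Pv)))))
        , (λ u·v-value → subst T (sym (trans c≡ (cong (λ z → z / r) (trans (cong₂ _·_ w≡Pu w'≡Pv) (P-dot u∈ v∈)))))
                                (values (u · v) u·v-value)) ]′ (orbit-dot u∈ v∈)
      T⇒cosine : ∀ c → T c → IsCosineOf (image P (orbit H)) r c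
      T⇒cosine c Tc = from-witness (proj₁ (proj₂ (realised c Tc))) (proj₂ (proj₂ (realised c Tc)))
                                   (witness (proj₁ (proj₂ (realised c Tc))))
        where
        from-witness : ∀ {d} → InnerValue d → c ≡ (d - + s) / r → Witness d → IsCosineOf (image P (orbit H)) r c
        from-witness {d} d-value c≡ (u , v , u∈ , v∈ , _ , u·v≡d) =
          P u , P v , (u , u∈ , refl) , (v , v∈ , refl) , Pu≢Pv , trans c≡ (cong (λ z → z / r) (sym Pu·Pv≡))
          where
          Pu·Pv≡ : P u · P v ≡ d - + s
          Pu·Pv≡ = trans (P-dot u∈ v∈) (cong (_- + s) u·v≡d)
          Pu≢Pv : P u ≢ P v
          Pu≢Pv Pu≡Pv = inner-value≢16 d-value (begin
            d                   ≡⟨ solve 2 (λ d s → d := (d :- s) :+ s) refl d (+ s) ⟩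
            (d - + s) + + s     ≡⟨ cong (_+ + s) (trans (sym Pu·Pv≡)
                                     (trans (cong (P u ·_) (sym Pu≡Pv)) (norm (P u) (u , u∈ , refl)))) ⟩
            + r + + s           ≡⟨ cong (_+ + s) (sym 16-s≡r) ⟩
            (+ 16 - + s) + + s  ≡⟨ solve 1 (λ s → (con (+ 16) :- s) :+ s := con (+ 16)) refl (+ s) ⟩
            + 16                ∎)
            where open ≡-Reasoning

    orbit-cosines : HasCosineSet (orbit H) 16 (λ c → c ≡ (+ 0) / 1 ⊎ c ≡ (+ 1) / 4 ⊎ c ≡ -1ℤ / 4)
    orbit-cosines = HasCosineSet-cong
      (λ w → mk⇔ (λ (u , u∈ , w≡u) → subst (orbit H) (sym w≡u) u∈) (λ w∈ → w , w∈ , refl))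
      (image-cosines id 0 16 (λ {u} {v} _ _ → sym (ℤP.+-identityʳ (u · v))) refl _
        (λ { _ (inj₁ refl) → inj₁ refl ; _ (inj₂ (inj₁ refl)) → inj₂ (inj₁ refl)
           ; _ (inj₂ (inj₂ refl)) → inj₂ (inj₂ refl) })
        (λ { _ (inj₁ c≡) → + 0 , inj₁ refl , c≡ ; _ (inj₂ (inj₁ c≡)) → + 4 , inj₂ (inj₁ refl) , c≡
           ; _ (inj₂ (inj₂ c≡)) → - + 4 , inj₂ (inj₂ refl) , c≡ }))

    cosines-off-ω₀ : HasCosineSet (image (projOff singleton₀) (orbit H)) 15
      (λ c → c ≡ -1ℤ / 3 ⊎ c ≡ -1ℤ / 15 ⊎ c ≡ (+ 1) / 5)
    cosines-off-ω₀ = image-cosines (projOff singleton₀) 1 15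
      (projection-dot singleton₀ (λ ω ω≡ω₀ → inj₁ (⌊⌋-sound (ω ≟Ω ω₀) ω≡ω₀))) refl _
      (λ { _ (inj₁ refl) → inj₂ (inj₁ refl) ; _ (inj₂ (inj₁ refl)) → inj₂ (inj₂ refl)
         ; _ (inj₂ (inj₂ refl)) → inj₁ refl })
      (λ { _ (inj₁ c≡) → - + 4 , inj₂ (inj₂ refl) , c≡ ; _ (inj₂ (inj₁ c≡)) → + 0 , inj₁ refl , c≡
         ; _ (inj₂ (inj₂ c≡)) → + 4 , inj₂ (inj₁ refl) , c≡ })

    cosines-off-ω₀ω₁ : ω₁ ≢ ω₀ → HasCosineSet (image (projOff (pair₀₁ ω₁)) (orbit H)) 14
      (λ c → c ≡ (- (+ 3)) / 7 ⊎ c ≡ -1ℤ / 7 ⊎ c ≡ (+ 1) / 7)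
    cosines-off-ω₀ω₁ ω₁≢ω₀ = image-cosines (projOff (pair₀₁ ω₁)) 2 14
      (λ {u} {v} u∈ v∈ → trans (projection-dot (pair₀₁ ω₁) in-pair u∈ v∈)
                                (cong (λ k → u · v - + k) (card-pair₀₁ ω₁ ω₁≢ω₀))) refl _
      (λ { _ (inj₁ refl) → inj₂ (inj₁ refl) ; _ (inj₂ (inj₁ refl)) → inj₂ (inj₂ refl)
         ; _ (inj₂ (inj₂ refl)) → inj₁ refl })
      (λ { _ (inj₁ c≡) → - + 4 , inj₂ (inj₂ refl) , c≡ ; _ (inj₂ (inj₁ c≡)) → + 0 , inj₁ refl , c≡
         ; _ (inj₂ (inj₂ c≡)) → + 4 , inj₂ (inj₁ refl) , c≡ })
      where
      in-pair : ∀ ω → pair₀₁ ω₁ ω ≡ true → ω ≡ ω₀ ⊎ ω ≡ ω₁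
      in-pair ω ω∈ = Data.Sum.map (⌊⌋-sound (ω ≟Ω ω₀)) (⌊⌋-sound (ω ≟Ω ω₁)) (∨≡true ⌊ ω ≟Ω ω₀ ⌋ ω∈)

theorem4p11 : (ω₁ : Ω) (B₀ : SubΩ) → ω₁ ≢ ω₀ → IsLinearHyperplane B₀ → B₀ ω₁ ≡ false →
    (H : Mat → Set) → In𝒢 ω₁ B₀ H →
    (∀ h A q → H h → InRM 2 A → InQ ω₁ B₀ q → h ≡ εM A ⊗ πM q → InRM 1 A ⊎ HasDefect A 2) →
    HasSize (orbit H) 64 →
    HasCosineSet (orbit H) 16
      (λ c → c ≡ (+ 0) / 1 ⊎ c ≡ (+ 1) / 4 ⊎ c ≡ -1ℤ / 4) ×
    HasCosineSet (image (projOff singleton₀) (orbit H)) 15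
      (λ c → c ≡ -1ℤ / 3 ⊎ c ≡ -1ℤ / 15 ⊎ c ≡ (+ 1) / 5) ×
    HasCosineSet (image (projOff (pair₀₁ ω₁)) (orbit H)) 14
      (λ c → c ≡ (- (+ 3)) / 7 ⊎ c ≡ -1ℤ / 7 ⊎ c ≡ (+ 1) / 7)
theorem4p11 ω₁ B₀ ω₁≢ω₀ _ _ H H∈𝒢 defect size = orbit-cosines , cosines-off-ω₀ , cosines-off-ω₀ω₁ ω₁≢ω₀
  where open Orbit ω₁ B₀ H H∈𝒢 defect
        open Witnesses size
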